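{- Let $\mathcal O$ be a non-degenerate conic of $\mathrm{PG}(2,q^2)$, so that in the Bruck–Bose representation $[\mathcal O]=\mathcal Q_\infty\cap\mathcal Q_0$. In $\mathrm{PG}(4,q^2)$, for each $t\in\mathbb F_q\cup\{\infty\}$ the quadric $\mathcal Q_t^\star$ of the pencil $t\mathcal Q_\infty^\star+\mathcal Q_0^\star$ meets the transversal $g$ in $0$, $1$ or $2$ points, according as $\mathcal O$ meets $\ell_\infty$ in $0$, $1$ or $2$ points respectively.
   Context: Bruck–Bose setting: $q$ is a prime power; $\tau$ is a primitive element of $\mathbb F_{q^2}$ with minimal polynomial $x^2-t_1x-t_0$ over $\mathbb F_q$. In $\mathrm{PG}(2,q^2)$, $\ell_\infty$ is $z=0$; in $\mathrm{PG}(4,q)$ with coordinates $(x_0,x_1,y_0,y_1,z)$, $\Sigma_\infty$ is $z=0$. The affine point $(x_0+x_1\tau,y_0+y_1\tau,1)$ corresponds to $(x_0,x_1,y_0,y_1,1)$; points of $\ell_\infty$ correspond to lines of a regular spread $\mathcal S$ of $\Sigma_\infty$. The transversals of $\mathcal S$ are the lines $g=\langle A_0,A_1\rangle$, $g^q=\langle A_0^q,A_1^q\rangle$ of $\mathrm{PG}(4,q^2)$ with $A_0=(\tau^q,-1,0,0,0)$, $A_1=(0,0,\tau^q,-1,0)$ ($X^q$ raises coordinates to the $q$-th power). If $\mathcal O$ has equation $f(x,y,z)=0$ with $f$ a quadratic form over $\mathbb F_{q^2}$, substituting $x=x_0+x_1\tau$, $y=y_0+y_1\tau$ and $z\in\mathbb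 F_q$ and reducing with $\tau^2=t_1\tau+t_0$ gives $f=f_\infty+\tau f_0$ with $f_\infty,f_0$ quadratic forms over $\mathbb F_q$ in $(x_0,x_1,y_0,y_1,z)$; $\mathcal Q_\infty,\mathcal Q_0$ are the quadrics $f_\infty=0$, $f_0=0$ of $\mathrm{PG}(4,q)$, and $[\mathcal O]=\mathcal Q_\infty\cap\mathcal Q_0$. $\mathcal Q_t$ denotes the quadric $tf_\infty+f_0=0$ (with $\mathcal Q_\infty$ for $t=\infty$), and $\mathcal Q_t^\star$ the quadric of $\mathrm{PG}(4,q^2)$ with the same equation. -}

module Defs where

open import Level using (Level; _⊔_) renaming (suc to lsuc)
open import Algebra.Bundles using (CommutativeRing)
open import Data.Nat using (ℕ; zero; suc) renaming (_+_ to _+ℕ_)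
open import Data.Fin using (Fin) renaming (zero to f0; suc to fs)
open import Data.List using (List; length; filter; cartesianProduct)
open import Data.List.Relation.Unary.Any using (Any)
open import Data.List.Relation.Unary.AllPairs using (AllPairs)
open import Data.Product using (_×_; _,_; proj₁; proj₂; ∃)
open import Data.Product.Relation.Binary.Pointwise.NonDependent using (×-decidable)
open import Data.Maybe using (Maybe; just; nothing)
open import Relation.Nullary using (¬_; Dec; yes; no)
open import Relation.Binary using (Decidable)

record FiniteField (c ℓ : Level) : Set (lsuc (c ⊔ ℓ)) where
  field
    commRing : CommutativeRing c ℓ
  open CommutativeRing commRing public hiding (ring)
  field
    _≟_      : Decidable _≈_
    0≉1      : ¬ (0# ≈ 1#)
    inverse  : ∀ x → ¬ (x ≈ 0#) → ∃ λ y → (x * y) ≈ 1#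
    elems    : List Carrier
    complete : ∀ x → Any (x ≈_) elems
    distinct : AllPairs (λ a b → ¬ (a ≈ b)) elems

  order : ℕ
  order = length elems

-- Bruck–Bose setting over F = F_q, with τ² = t₁τ + t₀.
module BruckBose {c ℓ : Level} (F : FiniteField c ℓ) (t0 t1 : FiniteField.Carrier F) where
  open FiniteField F

  q : ℕ
  q = order

  Irreducible : Set (c ⊔ ℓ)
  Irreducible = ∀ r → ¬ ((r * r) ≈ ((t1 * r) + t0))

  -- F_{q²} = F_q[τ], element (a , b) stands for a + bτ
  E : Set c
  E = Carrier × Carrier

  _≈E_ : E → E → Set ℓ
  (a , b) ≈E (a' , b') = (a ≈ a') × (b ≈ b')

  _≟E_ : Decidable _≈E_
  (a , b) ≟E (a' , b') = ×-decidable _≟_ _≟_ (a , b) (a' , b')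

  0E 1E τE : E
  0E = (0# , 0#)
  1E = (1# , 0#)
  τE = (0# , 1#)

  emb : Carrier → E
  emb a = (a , 0#)

  _+E_ _*E_ : E → E → E
  (a , b) +E (a' , b') = (a + a' , b + b')
  -- (a + bτ)(a' + b'τ) = aa' + bb't₀ + (ab' + ba' + bb't₁)τ
  (a , b) *E (a' , b') = ((a * a') + ((b * b') * t0) , ((a * b') + (b * a')) + ((b * b') * t1))

  -E_ : E → E
  -E (a , b) = (- a , - b)

  _^E_ : E → ℕ → E
  x ^E zero = 1E
  x ^E suc n = x *E (x ^E n)

  Primitive : Set (c ⊔ ℓ)
  Primitive = ∀ x → ¬ (x ≈E 0E) → ∃ λ k → (τE ^E k) ≈E x

  elemsE : List E
  elemsE = cartesianProduct elems elems

  sumFin : ∀ n → (Fin n → E) → E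
  sumFin zero    v = 0E
  sumFin (suc n) v = v f0 +E sumFin n (λ i → v (fs i))

  record Conic : Set c where
    field
      ca cb cc cd ce ch : E

  evalConic : Conic → E → E → E → E
  evalConic O x y z =
    ((((((ca *E (x *E x)) +E (cb *E (y *E y))) +E (cc *E (z *E z)))
      +E (cd *E (x *E y))) +E (ce *E (x *E z))) +E (ch *E (y *E z)))
    where open Conic O

  -- non-degenerate: 4abc + deh - ah² - be² - cd² ≠ 0 (characteristic-free)
  NonDegenerate : Conic → Set ℓ
  NonDegenerate O =
    ¬ ((((((four *E ((ca *E cb) *E cc)) +E ((cd *E ce) *E ch))
        +E (-E (ca *E (ch *E ch)))) +E (-E (cb *E (ce *E ce))))
        +E (-E (cc *E (cd *E cd)))) ≈E 0E)
    where
      open Conic O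
      four = ((1E +E 1E) +E 1E) +E 1E

  -- quadratic forms in the 5 coordinates (x₀,x₁,y₀,y₁,z), as coefficient
  -- arrays: Σᵢ Σⱼ Cᵢⱼ Xᵢ Xⱼ
  QF5 : Set c
  QF5 = Fin 5 → Fin 5 → E

  -- the linear forms x = x₀ + x₁τ, y = y₀ + y₁τ, z
  lx ly lz : Fin 5 → E
  lx f0 = 1E
  lx (fs f0) = τE
  lx _ = 0E
  ly (fs (fs f0)) = 1E
  ly (fs (fs (fs f0))) = τE
  ly _ = 0E
  lz (fs (fs (fs (fs f0)))) = 1E
  lz _ = 0E

  _⊗_ : (Fin 5 → E) → (Fin 5 → E) → QF5
  (L ⊗ M) i j = L i *E M j

  _·Q_ : E → QF5 → QF5
  (s ·Q C) i j = s *E C i j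

  _+Q_ : QF5 → QF5 → QF5
  (C +Q D) i j = C i j +E D i j

  substituted : Conic → QF5
  substituted O =
    (((((ca ·Q (lx ⊗ lx)) +Q (cb ·Q (ly ⊗ ly))) +Q (cc ·Q (lz ⊗ lz)))
      +Q (cd ·Q (lx ⊗ ly))) +Q (ce ·Q (lx ⊗ lz))) +Q (ch ·Q (ly ⊗ lz))
    where open Conic O

  -- f = f∞ + τ f₀ with f∞, f₀ over F_q (coefficient arrays over F_q)
  f∞ f₀ : Conic → Fin 5 → Fin 5 → Carrier
  f∞ O i j = proj₁ (substituted O i j)
  f₀ O i j = proj₂ (substituted O i j)

  -- the pencil: Q_t : t f∞ + f₀ (t ∈ F_q), Q_∞ : f∞  (nothing = ∞)
  pencil : Conic → Maybe Carrier → Fin 5 → Fin 5 → Carrier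
  pencil O (just t) i j = (t * f∞ O i j) + f₀ O i j
  pencil O nothing  i j = f∞ O i j

  evalQ⋆ : Conic → Maybe Carrier → (Fin 5 → E) → E
  evalQ⋆ O t v = sumFin 5 λ i → sumFin 5 λ j → (emb (pencil O t i j) *E v i) *E v j

  frob : E → E
  frob x = x ^E q

  A0 A1 : Fin 5 → E
  A0 f0 = frob τE
  A0 (fs f0) = -E 1E
  A0 _ = 0E
  A1 (fs (fs f0)) = frob τE
  A1 (fs (fs (fs f0))) = -E 1E
  A1 _ = 0E

  indicator : {A : Set ℓ} → Dec A → ℕ
  indicator (yes _) = 1
  indicator (no _)  = 0

  -- number of points of the transversal g = ⟨A₀,A₁⟩ lying on Q_t^⋆;
  -- the points of g are ⟨A₀ + μA₁⟩ (μ ∈ F_{q²}) and ⟨A₁⟩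
  pointOfG : E → Fin 5 → E
  pointOfG μ i = A0 i +E (μ *E A1 i)

  #g∩Q⋆ : Conic → Maybe Carrier → ℕ
  #g∩Q⋆ O t =
    length (filter (λ μ → evalQ⋆ O t (pointOfG μ) ≟E 0E) elemsE)
    +ℕ indicator (evalQ⋆ O t A1 ≟E 0E)

  -- number of points of O on ℓ∞ (z = 0): points (1:μ:0), μ ∈ F_{q²}, and (0:1:0)
  #O∩ℓ∞ : Conic → ℕ
  #O∩ℓ∞ O =
    length (filter (λ μ → evalConic O 1E μ 0E ≟E 0E) elemsE)
    +ℕ indicator (evalConic O 0E 1E 0E ≟E 0E)

module Submission where

open import Defs
open import Relation.Binary.PropositionalEquality using (_≡_)
open import Data.Maybe using (Maybe)
open import Level using (Level)
open import Algebra.Bundles using (CommutativeRing; CommutativeMonoid)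

-- Theorem 4.1.  Every quadric Q_t^⋆ of the pencil t f∞ + f₀ meets the
-- transversal g in as many points as the conic O meets ℓ∞.
--
-- For u = u∞ + u₀τ, (τ - τ̄)(t u∞ + u₀) = α_t ū + β_t u, so (τ - τ̄) Q_t^⋆ is
-- α_t f̄(x̄, ȳ, z̄) + β_t f(x, y, z).  Since the Frobenius map sends τ to τ^q = τ̄,
-- at the point X A₀ + Y A₁ of g we get x̄ = ȳ = z̄ = 0, x = dX, y = dY, z = 0
-- (d = τ̄ - τ), so (τ - τ̄) Q_t^⋆(X A₀ + Y A₁) = β_t d² f(X, Y, 0) with nonzero
-- factors: ⟨A₀ + μA₁⟩ ∈ Q_t^⋆ ⇔ (1 : μ : 0) ∈ O and ⟨A₁⟩ ∈ Q_t^⋆ ⇔ (0 : 1 : 0) ∈ O.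

-- Instantiating the library's ring solver with integer coefficients along ι
-- lets it prove identities with numerals, such as x * 0# ≈ 0#, over an
-- arbitrary commutative ring (with coefficients taken in R itself such
-- constants would not normalise).  Multiples are the library's optimised
-- ones, so that ι 0 and ι 1 are literally 0# and 1#.
module ℤSolver {a ℓ : Level} (R : CommutativeRing a ℓ) where
  open import Data.Nat as ℕ using (ℕ; zero; suc)
  import Data.Nat.Properties as ℕ
  open import Data.Integer as ℤ using (ℤ; +_; -[1+_]; _⊖_; _◃_)
  import Data.Integer.Properties as ℤ
  open import Data.Sign as Sign using (Sign)
  open import Data.Maybe using (Maybe; just; nothing)
  open import Relation.Nullary using (yes; no)
  import Relation.Binary.PropositionalEquality as P

  open CommutativeRing R
  open import Algebra.Properties.Semiring.Mult.TCOptimised semiring using (_×_; ×-homo-+; ×1-homo-*; 1+×)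
  open import Algebra.Properties.Ring ring using (-‿involutive; -0#≈0#; -‿distribˡ-*; -‿distribʳ-*; -‿+-comm)
  open import Algebra.Solver.Ring.AlmostCommutativeRing using (fromCommutativeRing; _-Raw-AlmostCommutative⟶_)
  open import Relation.Binary.Reasoning.Setoid setoid

  ι : ℤ → Carrier
  ι (+ n)    = n × 1#
  ι -[1+ n ] = - (suc n × 1#)

  ι-⊖ : ∀ m n → ι (m ⊖ n) ≈ m × 1# - n × 1#
  ι-⊖ zero    zero    = sym (-‿inverseʳ 0#)
  ι-⊖ zero    (suc n) = sym (+-identityˡ _)
  ι-⊖ (suc m) zero    = sym (trans (+-congˡ -0#≈0#) (+-identityʳ _))
  ι-⊖ (suc m) (suc n) = begin
    ι (suc m ⊖ suc n)                 ≡⟨ P.cong ι (ℤ.[1+m]⊖[1+n]≡m⊖n m n) ⟩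
    ι (m ⊖ n)                         ≈⟨ ι-⊖ m n ⟩
    M - N                             ≈⟨ shift ⟩
    (1# + M) - (1# + N)               ≈⟨ +-cong (sym (1+× m 1#)) (-‿cong (sym (1+× n 1#))) ⟩
    suc m × 1# - suc n × 1#           ∎
    where
    M N : Carrier
    M = m × 1#
    N = n × 1#
    shift : M - N ≈ (1# + M) - (1# + N)
    shift = begin
      M - N                   ≈⟨ sym (+-identityˡ _) ⟩
      0# + (M - N)            ≈⟨ +-congʳ (sym (-‿inverseʳ 1#)) ⟩
      (1# - 1#) + (M - N)     ≈⟨ +-assoc 1# (- 1#) _ ⟩
      1# + (- 1# + (M - N))   ≈⟨ +-congˡ (sym (+-assoc (- 1#) M _)) ⟩
      1# + ((- 1# + M) - N)   ≈⟨ +-congˡ (+-congʳ (+-comm _ _)) ⟩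
      1# + ((M - 1#) - N)     ≈⟨ +-congˡ (+-assoc M _ _) ⟩
      1# + (M + (- 1# - N))   ≈⟨ sym (+-assoc 1# M _) ⟩
      (1# + M) + (- 1# - N)   ≈⟨ +-congˡ (-‿+-comm 1# N) ⟩
      (1# + M) - (1# + N)     ∎

  ι-+ : ∀ i j → ι (i ℤ.+ j) ≈ ι i + ι j
  ι-+ (+ m)    (+ n)    = ×-homo-+ 1# m n
  ι-+ (+ m)    -[1+ n ] = ι-⊖ m (suc n)
  ι-+ -[1+ m ] (+ n)    = trans (ι-⊖ n (suc m)) (+-comm _ _)
  ι-+ -[1+ m ] -[1+ n ] = begin
    - (suc (suc (m ℕ.+ n)) × 1#)          ≡⟨ P.cong (λ k → - (suc k × 1#)) (P.sym (ℕ.+-suc m n)) ⟩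
    - ((suc m ℕ.+ suc n) × 1#)            ≈⟨ -‿cong (×-homo-+ 1# (suc m) (suc n)) ⟩
    - (suc m × 1# + suc n × 1#)           ≈⟨ sym (-‿+-comm _ _) ⟩
    - (suc m × 1#) - (suc n × 1#)         ∎

  signed : Sign → Carrier → Carrier
  signed Sign.+ x = x
  signed Sign.- x = - x

  ι-◃ : ∀ s n → ι (s ◃ n) ≈ signed s (n × 1#)
  ι-◃ Sign.+ zero    = refl
  ι-◃ Sign.+ (suc n) = refl
  ι-◃ Sign.- zero    = sym -0#≈0#
  ι-◃ Sign.- (suc n) = refl

  ι-signAbs : ∀ i → ι i ≈ signed (ℤ.sign i) (ℤ.∣ i ∣ × 1#)
  ι-signAbs (+ n)    = refl
  ι-signAbs -[1+ n ] = refl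

  signed-* : ∀ s t x y → signed (s Sign.* t) (x * y) ≈ signed s x * signed t y
  signed-* Sign.+ Sign.+ x y = refl
  signed-* Sign.+ Sign.- x y = -‿distribʳ-* x y
  signed-* Sign.- Sign.+ x y = -‿distribˡ-* x y
  signed-* Sign.- Sign.- x y = begin
    x * y             ≈⟨ sym (-‿involutive _) ⟩
    - - (x * y)       ≈⟨ -‿cong (-‿distribʳ-* x y) ⟩
    - (x * - y)       ≈⟨ -‿distribˡ-* x (- y) ⟩
    - x * - y         ∎

  signed-cong : ∀ s {x y} → x ≈ y → signed s x ≈ signed s y
  signed-cong Sign.+ p = p
  signed-cong Sign.- p = -‿cong p

  ι-* : ∀ i j → ι (i ℤ.* j) ≈ ι i * ι j
  ι-* i j = begin
    ι (i ℤ.* j)                                 ≈⟨ ι-◃ (s Sign.* t) (∣ i ∣ ℕ.* ∣ j ∣) ⟩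
    signed (s Sign.* t) ((∣ i ∣ ℕ.* ∣ j ∣) × 1#)   ≈⟨ signed-cong (s Sign.* t) (×1-homo-* ∣ i ∣ ∣ j ∣) ⟩
    signed (s Sign.* t) ((∣ i ∣ × 1#) * (∣ j ∣ × 1#)) ≈⟨ signed-* s t _ _ ⟩
    signed s (∣ i ∣ × 1#) * signed t (∣ j ∣ × 1#)   ≈⟨ *-cong (sym (ι-signAbs i)) (sym (ι-signAbs j)) ⟩
    ι i * ι j                                   ∎
    where
    s t : Sign
    s = ℤ.sign i
    t = ℤ.sign j
    ∣_∣ : ℤ → ℕ
    ∣_∣ = ℤ.∣_∣

  ι-neg : ∀ i → ι (ℤ.- i) ≈ - ι i
  ι-neg (+ zero)  = sym -0#≈0#
  ι-neg (+ suc n) = refl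
  ι-neg -[1+ n ]  = sym (-‿involutive _)

  ι-morphism : ℤ.+-*-rawRing -Raw-AlmostCommutative⟶ fromCommutativeRing R
  ι-morphism = record
    { ⟦_⟧ = ι ; +-homo = ι-+ ; *-homo = ι-* ; -‿homo = ι-neg ; 0-homo = refl ; 1-homo = refl }

  -- the solver compares coefficients only through this test
  ι-equal? : ∀ i j → Maybe (ι i ≈ ι j)
  ι-equal? i j with i ℤ.≟ j
  ... | yes P.refl = just refl
  ... | no _       = nothing

  open import Algebra.Solver.Ring ℤ.+-*-rawRing (fromCommutativeRing R) ι-morphism ι-equal? public

module Polynomials {a ℓ : Level} (R : CommutativeRing a ℓ) where
  open import Data.Nat as ℕ using (ℕ; zero; suc; s≤s; z≤n)
  open import Data.Integer using (+_)
  open import Data.Fin using (Fin; toℕ; fromℕ) renaming (zero to fzero; suc to fsuc)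
  open import Data.List using (List; []; _∷_; length)
  open import Data.Fin.Properties using (toℕ-fromℕ)
  open import Data.List.Relation.Unary.All as All using (All; []; _∷_)
  open import Data.List.Relation.Unary.AllPairs using (AllPairs; []; _∷_)
  import Relation.Binary.PropositionalEquality as P
  open P using (_≡_)

  open CommutativeRing R
  open ℤSolver R
  open import Relation.Binary.Reasoning.Setoid setoid
  open import Algebra.Properties.Semiring.Exp semiring using (_^_)

  Poly : ℕ → Set a
  Poly n = Fin n → Carrier

  tail : ∀ {n} → Poly (suc n) → Poly n
  tail f k = f (fsuc k)

  eval : ∀ {n} → Poly n → Carrier → Carrier
  eval {zero}  f x = 0#
  eval {suc n} f x = f fzero + x * eval (tail f) x

  eval-zero : ∀ {n} (f : Poly n) → (∀ k → f k ≈ 0#) → ∀ x → eval f x ≈ 0#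
  eval-zero {zero}  f f≈0 x = refl
  eval-zero {suc n} f f≈0 x = begin
    f fzero + x * eval (tail f) x ≈⟨ +-cong (f≈0 fzero) (*-congˡ (eval-zero (tail f) (λ k → f≈0 (fsuc k)) x)) ⟩
    0# + x * 0#                   ≈⟨ solve 1 (λ x → con (+ 0) :+ x :* con (+ 0) := con (+ 0)) refl x ⟩
    0#                            ∎

  eval-sub : ∀ {n} (f g : Poly n) x → eval (λ k → f k - g k) x ≈ eval f x - eval g x
  eval-sub {zero}  f g x = solve 0 (con (+ 0) := con (+ 0) :- con (+ 0)) refl
  eval-sub {suc n} f g x = begin
    (f fzero - g fzero) + x * eval (λ k → tail f k - tail g k) x ≈⟨ +-congˡ (*-congˡ (eval-sub (tail f) (tail g) x)) ⟩
    (f fzero - g fzero) + x * (eval (tail f) x - eval (tail g) x) ≈⟨ solve 5 (λ a b x u v → (a :- b) :+ x :* (u :- v) := (a :+ x :* u) :- (b :+ x :* v))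
                                                                          refl (f fzero) (g fzero) x _ _ ⟩
    (f fzero + x * eval (tail f) x) - (g fzero + x * eval (tail g) x) ∎

  monomial : ∀ {n} → Fin n → Poly n
  monomial fzero    fzero    = 1#
  monomial fzero    (fsuc j) = 0#
  monomial (fsuc k) fzero    = 0#
  monomial (fsuc k) (fsuc j) = monomial k j

  eval-monomial : ∀ {n} (k : Fin n) x → eval (monomial k) x ≈ x ^ toℕ k
  eval-monomial {suc n} fzero    x = begin
    1# + x * eval (λ (j : Fin n) → 0#) x ≈⟨ +-congˡ (*-congˡ (eval-zero {n} _ (λ _ → refl) x)) ⟩
    1# + x * 0#                          ≈⟨ solve 1 (λ x → con (+ 1) :+ x :* con (+ 0) := con (+ 1)) refl x ⟩
    1#                                   ∎
  eval-monomial {suc n} (fsuc k) x = trans (+-identityˡ _) (*-congˡ (eval-monomial k x))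

  -- value at c of the polynomial p shifted down by k (p_k + p_{k+1} c + ⋯)
  shiftedValue : ∀ {n} → Carrier → Poly n → Poly n
  shiftedValue {suc n} c p fzero    = eval p c
  shiftedValue {suc n} c p (fsuc k) = shiftedValue c (tail p) k

  -- the quotient of f by x - c
  quotient : ∀ {n} → Carrier → Poly (suc n) → Poly n
  quotient c f = shiftedValue c (tail f)

  division : ∀ {n} (f : Poly (suc n)) c x → eval f x ≈ eval f c + (x - c) * eval (quotient c f) x
  division {zero}  f c x =
    solve 3 (λ f₀ x c → f₀ :+ x :* con (+ 0) := f₀ :+ c :* con (+ 0) :+ (x :- c) :* con (+ 0)) refl (f fzero) x c
  division {suc n} f c x = begin
    f fzero + x * eval (tail f) x         ≈⟨ +-congˡ (*-congˡ (division (tail f) c x)) ⟩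
    f fzero + x * (A + (x - c) * Q)       ≈⟨ solve 5 (λ f₀ x c A Q → f₀ :+ x :* (A :+ (x :- c) :* Q) := f₀ :+ c :* A :+ (x :- c) :* (A :+ x :* Q))
                                                   refl (f fzero) x c A Q ⟩
    f fzero + c * A + (x - c) * (A + x * Q) ∎
    where
    A Q : Carrier
    A = eval (tail f) c
    Q = eval (quotient c (tail f)) x

  -- p is recovered from its shifted values: p_k = s_k - c s_{k+1}
  shiftedValue-zero : ∀ {n} c (p : Poly n) → (∀ k → shiftedValue c p k ≈ 0#) → ∀ k → p k ≈ 0#
  shiftedValue-zero {suc n} c p s≈0 fzero    = begin
    p fzero                      ≈⟨ solve 2 (λ p₀ c → p₀ := p₀ :+ c :* con (+ 0)) refl (p fzero) c ⟩
    p fzero + c * 0#             ≈⟨ +-congˡ (*-congˡ (sym (eval-zero (tail p) (shiftedValue-zero c (tail p) (λ k → s≈0 (fsuc k))) c))) ⟩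
    p fzero + c * eval (tail p) c ≈⟨ s≈0 fzero ⟩
    0#                           ∎
  shiftedValue-zero {suc n} c p s≈0 (fsuc k) = shiftedValue-zero c (tail p) (λ j → s≈0 (fsuc j)) k

  -- c and d are separated if d - c is not a zero divisor (e.g. c ≉ d in a field)
  Separated : Carrier → Carrier → Set (a Level.⊔ ℓ)
  Separated c d = ∀ z → (d - c) * z ≈ 0# → z ≈ 0#

  quotient-roots : ∀ {n} (f : Poly (suc n)) c {ds : List Carrier} → eval f c ≈ 0# → All (Separated c) ds →
                   All (λ d → eval f d ≈ 0#) ds → All (λ d → eval (quotient c f) d ≈ 0#) ds
  quotient-roots f c {[]}     fc≈0 []           []           = []
  quotient-roots f c {d ∷ ds} fc≈0 (sep ∷ seps) (fd≈0 ∷ fds) = sep _ root ∷ quotient-roots f c fc≈0 seps fds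
    where
    root : (d - c) * eval (quotient c f) d ≈ 0#
    root = begin
      (d - c) * eval (quotient c f) d            ≈⟨ sym (+-identityˡ _) ⟩
      0# + (d - c) * eval (quotient c f) d       ≈⟨ +-congʳ (sym fc≈0) ⟩
      eval f c + (d - c) * eval (quotient c f) d ≈⟨ sym (division f c d) ⟩
      eval f d                                   ≈⟨ fd≈0 ⟩
      0#                                         ∎

  roots⇒zero : ∀ {n} (f : Poly n) (cs : List Carrier) → n ℕ.≤ length cs → AllPairs Separated cs →
               All (λ c → eval f c ≈ 0#) cs → ∀ k → f k ≈ 0#
  roots⇒zero {zero}  f cs       n≤ seps roots ()
  roots⇒zero {suc n} f (c ∷ cs) (s≤s n≤) (sep ∷ seps) (fc≈0 ∷ roots) = coefficient
    where
    tail≈0 : ∀ k → tail f k ≈ 0#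
    tail≈0 = shiftedValue-zero c (tail f)
               (roots⇒zero (quotient c f) cs n≤ seps (quotient-roots f c fc≈0 sep roots))
    coefficient : ∀ k → f k ≈ 0#
    coefficient fzero    = begin
      f fzero                       ≈⟨ solve 2 (λ f₀ c → f₀ := f₀ :+ c :* con (+ 0)) refl (f fzero) c ⟩
      f fzero + c * 0#              ≈⟨ +-congˡ (*-congˡ (sym (eval-zero (tail f) tail≈0 c))) ⟩
      eval f c                      ≈⟨ fc≈0 ⟩
      0#                            ∎
    coefficient (fsuc k) = tail≈0 k

  monomial-top : ∀ k → monomial (fromℕ k) (fromℕ k) ≡ 1#
  monomial-top zero    = P.refl
  monomial-top (suc k) = monomial-top k

  -- x^k - x (k ≥ 2) has at most k pairwise separated roots: k + 1 of them
  -- would make all its coefficients, in particular the leading 1#, vanish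
  power-roots : ∀ k → 2 ℕ.≤ k → (cs : List Carrier) → suc k ℕ.≤ length cs → AllPairs Separated cs →
                All (λ c → c ^ k ≈ c) cs → 1# ≈ 0#
  power-roots k@(suc (suc m)) (s≤s (s≤s z≤n)) cs k<cs seps fixed = begin
    1#                 ≈⟨ solve 1 (λ u → u := u :- con (+ 0)) refl 1# ⟩
    1# - 0#            ≡⟨ P.cong (_- 0#) (P.sym (monomial-top k)) ⟩
    f (fromℕ k)        ≈⟨ roots⇒zero f cs k<cs seps (All.map (λ {c} → root c) fixed) (fromℕ k) ⟩
    0#                 ∎
    where
    xᵏ x¹ f : Poly (suc k)
    xᵏ = monomial (fromℕ k)
    x¹ = monomial (fsuc fzero)
    f j = xᵏ j - x¹ j
    root : ∀ c → c ^ k ≈ c → eval f c ≈ 0#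
    root c cᵏ≈c = begin
      eval f c                   ≈⟨ eval-sub xᵏ x¹ c ⟩
      eval xᵏ c - eval x¹ c      ≈⟨ +-cong (eval-monomial (fromℕ k) c) (-‿cong (eval-monomial {suc k} (fsuc fzero) c)) ⟩
      c ^ toℕ (fromℕ k) - c * 1# ≡⟨ P.cong (λ e → c ^ e - c * 1#) (toℕ-fromℕ k) ⟩
      c ^ k - c * 1#             ≈⟨ +-congʳ cᵏ≈c ⟩
      c - c * 1#                 ≈⟨ solve 1 (λ c → c :- c :* con (+ 1) := con (+ 0)) refl c ⟩
      0#                         ∎

module Binomials {a ℓ : Level} (R : CommutativeRing a ℓ) where
  open import Data.Nat as ℕ using (ℕ; zero; suc; z≤n; s≤s; _∸_)
  open import Data.Nat.Properties using (n∸n≡0)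
  open import Data.Nat.Combinatorics using (_C_; nCn≡1; nCk≡nC[n∸k])
  open import Data.Integer using (+_)
  open import Data.Fin using (Fin; toℕ; fromℕ; fromℕ<; inject₁) renaming (zero to fzero; suc to fsuc)
  open import Data.Fin.Properties using (toℕ-fromℕ; toℕ-inject₁; toℕ-fromℕ<; toℕ<n)
  open import Data.List using (List; length)
  import Data.List.Relation.Unary.All as All
  open import Data.List.Relation.Unary.AllPairs using (AllPairs)
  import Relation.Binary.PropositionalEquality as P

  open CommutativeRing R
  open ℤSolver R using (solve; _:=_; _:+_; _:-_; con)
  open Polynomials R
  open import Relation.Binary.Reasoning.Setoid setoid
  open import Algebra.Properties.Semiring.Exp semiring using (_^_)
  open import Algebra.Properties.Semiring.Mult semiring using (_×_; ×-assoc-*; ×-homo-1; ×-congʳ)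
  open import Algebra.Properties.Semiring.Sum semiring using (sum; *-distribˡ-sum; sum-init-last; sum-cong-≋)
  open import Algebra.Properties.CommutativeSemiring.Binomial commutativeSemiring using (theorem)
  open import Algebra.Properties.CommutativeSemigroup *-commutativeSemigroup using (x∙yz≈y∙xz)

  1^ : ∀ n → 1# ^ n ≈ 1#
  1^ zero    = refl
  1^ (suc n) = trans (*-identityˡ _) (1^ n)

  eval-sum : ∀ {n} (f : Poly n) x → eval f x ≈ sum (λ k → f k * x ^ toℕ k)
  eval-sum {zero}  f x = refl
  eval-sum {suc n} f x = begin
    f fzero + x * eval (tail f) x                          ≈⟨ +-cong (sym (*-identityʳ _)) (*-congˡ (eval-sum (tail f) x)) ⟩
    f fzero * 1# + x * sum (λ k → tail f k * x ^ toℕ k)     ≈⟨ +-congˡ (*-distribˡ-sum {n} x _) ⟩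
    f fzero * 1# + sum (λ k → x * (tail f k * x ^ toℕ k))   ≈⟨ +-congˡ (sum-cong-≋ (λ k → x∙yz≈y∙xz x (tail f k) _)) ⟩
    f fzero * 1# + sum (λ k → tail f k * (x * x ^ toℕ k))   ∎

  middle : ∀ m → Carrier → Carrier → Fin m → Carrier
  middle m x y k = (suc m C suc (toℕ k)) × (x ^ suc (toℕ k) * y ^ (suc m ∸ suc (toℕ k)))

  binomial-ends : ∀ m x y → (x + y) ^ suc m ≈ y ^ suc m + (sum (middle m x y) + x ^ suc m)
  binomial-ends m x y = begin
    (x + y) ^ q                                                  ≈⟨ theorem q x y ⟩
    term fzero + sum (λ k → term (fsuc k))                       ≈⟨ +-congˡ (sum-init-last (λ k → term (fsuc k))) ⟩
    term fzero + (sum (λ k → term (fsuc (inject₁ k))) + term (fsuc (fromℕ m)))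
                                                                 ≈⟨ +-cong first (+-cong (sum-cong-≋ inner) last) ⟩
    y ^ q + (sum (middle m x y) + x ^ q)                         ∎
    where
    q : ℕ
    q = suc m
    term : Fin (suc q) → Carrier
    term k = (q C toℕ k) × (x ^ toℕ k * y ^ (q ∸ toℕ k))
    first : term fzero ≈ y ^ q
    first = begin
      (q C 0) × (1# * y ^ q) ≡⟨ P.cong (_× (1# * y ^ q)) (P.trans (nCk≡nC[n∸k] {n = q} z≤n) (nCn≡1 q)) ⟩
      1 × (1# * y ^ q)       ≈⟨ ×-homo-1 _ ⟩
      1# * y ^ q             ≈⟨ *-identityˡ _ ⟩
      y ^ q                  ∎
    last : term (fsuc (fromℕ m)) ≈ x ^ q
    last rewrite toℕ-fromℕ m = begin
      (q C q) × (x ^ q * y ^ (m ∸ m)) ≡⟨ P.cong₂ (λ c e → c × (x ^ q * y ^ e)) (nCn≡1 q) (n∸n≡0 m) ⟩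
      1 × (x ^ q * 1#)               ≈⟨ ×-homo-1 _ ⟩
      x ^ q * 1#                     ≈⟨ *-identityʳ _ ⟩
      x ^ q                          ∎
    inner : ∀ k → term (fsuc (inject₁ k)) ≈ middle m x y k
    inner k rewrite toℕ-inject₁ k = refl

  InnerBinomialsVanish : ℕ → Set ℓ
  InnerBinomialsVanish q = ∀ j → 0 ℕ.< j → j ℕ.< q → (q C j) × 1# ≈ 0#

  frobenius-additive : ∀ m → InnerBinomialsVanish (suc m) → ∀ x y → (x + y) ^ suc m ≈ x ^ suc m + y ^ suc m
  frobenius-additive m vanish x y = begin
    (x + y) ^ q                         ≈⟨ binomial-ends m x y ⟩
    y ^ q + (sum (middle m x y) + x ^ q) ≈⟨ +-congˡ (+-congʳ (sum-zero (middle m x y) inner≈0)) ⟩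
    y ^ q + (0# + x ^ q)                ≈⟨ solve 2 (λ a b → a :+ (con (+ 0) :+ b) := b :+ a) refl (y ^ q) (x ^ q) ⟩
    x ^ q + y ^ q                       ∎
    where
    q : ℕ
    q = suc m
    sum-zero : ∀ {n} (f : Fin n → Carrier) → (∀ k → f k ≈ 0#) → sum f ≈ 0#
    sum-zero {zero}  f f≈0 = refl
    sum-zero {suc n} f f≈0 = trans (+-cong (f≈0 fzero) (sum-zero (λ k → f (fsuc k)) (λ k → f≈0 (fsuc k)))) (+-identityˡ 0#)
    inner≈0 : ∀ k → middle m x y k ≈ 0#
    inner≈0 k = begin
      middle m x y k                           ≈⟨ sym (×1* (q C suc (toℕ k)) _) ⟩
      ((q C suc (toℕ k)) × 1#) * _             ≈⟨ *-congʳ (vanish (suc (toℕ k)) (s≤s z≤n) (s≤s (toℕ<n k))) ⟩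
      0# * _                                   ≈⟨ zeroˡ _ ⟩
      0#                                       ∎
      where
      ×1* : ∀ n y → (n × 1#) * y ≈ n × y
      ×1* n y = trans (×-assoc-* n 1# y) (×-congʳ n (*-identityˡ y))

  -- Conversely, if every element satisfies x^q = x and R contains q pairwise
  -- separated elements, the inner binomial coefficients vanish: the
  -- polynomial Σ_{0<j<q} C(q,j) x^j = (x+1)^q - 1 - x^q has q coefficients
  -- and vanishes everywhere.
  inner-binomials-vanish : ∀ m → (∀ x → x ^ suc m ≈ x) → (cs : List Carrier) → suc m ℕ.≤ length cs →
                           AllPairs Separated cs → InnerBinomialsVanish (suc m)
  inner-binomials-vanish m fermat cs q≤ seps (suc i) _ (s≤s i<m) =
    P.subst (λ j → (q C suc j) × 1# ≈ 0#) (toℕ-fromℕ< i<m) (g≈0 (fsuc (fromℕ< i<m)))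
    where
    q : ℕ
    q = suc m
    g : Poly q
    g fzero    = 0#
    g (fsuc k) = (q C suc (toℕ k)) × 1#
    g-inner : ∀ x → eval g x ≈ sum (middle m x 1#)
    g-inner x = begin
      eval g x                                             ≈⟨ eval-sum g x ⟩
      0# * 1# + sum (λ k → g (fsuc k) * (x * x ^ toℕ k))   ≈⟨ +-cong (zeroˡ _) (sum-cong-≋ term) ⟩
      0# + sum (middle m x 1#)                             ≈⟨ +-identityˡ _ ⟩
      sum (middle m x 1#)                                  ∎
      where
      term : ∀ k → g (fsuc k) * (x * x ^ toℕ k) ≈ middle m x 1# k
      term k = begin
        (c × 1#) * x^j         ≈⟨ ×-assoc-* c 1# x^j ⟩
        c × (1# * x^j)         ≈⟨ ×-congʳ c (*-identityˡ x^j) ⟩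
        c × x^j                ≈⟨ ×-congʳ c (sym (trans (*-congˡ (1^ (q ∸ suc (toℕ k)))) (*-identityʳ x^j))) ⟩
        middle m x 1# k        ∎
        where
        c : ℕ
        c = q C suc (toℕ k)
        x^j : Carrier
        x^j = x ^ suc (toℕ k)
    g-vanishes : ∀ x → eval g x ≈ 0#
    g-vanishes x = begin
      eval g x                             ≈⟨ g-inner x ⟩
      S                                    ≈⟨ solve 3 (λ s a b → s := (con (+ 1) :+ (s :+ b)) :- con (+ 1) :- b) refl S x (x ^ q) ⟩
      (1# + (S + x ^ q)) - 1# - x ^ q       ≈⟨ +-congʳ (+-congʳ (sym (trans (binomial-ends m x 1#) (+-congʳ (1^ q))))) ⟩
      (x + 1#) ^ q - 1# - x ^ q            ≈⟨ +-cong (+-congʳ (fermat _)) (-‿cong (fermat x)) ⟩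
      (x + 1#) - 1# - x                    ≈⟨ solve 1 (λ x → x :+ con (+ 1) :- con (+ 1) :- x := con (+ 0)) refl x ⟩
      0#                                   ∎
      where
      S : Carrier
      S = sum (middle m x 1#)
    g≈0 : ∀ k → g k ≈ 0#
    g≈0 = roots⇒zero g cs q≤ seps (All.universal g-vanishes cs)

module UniqueProducts {c ℓ : Level} (M : CommutativeMonoid c ℓ) where
  open import Data.List using (List; []; _∷_; foldr)
  open import Data.List.Relation.Unary.All using (All; _∷_)
  import Data.List.Relation.Unary.All.Properties as All
  open import Data.List.Relation.Unary.Any using (here; there; _─_)
  open import Data.List.Relation.Unary.AllPairs using (_∷_)
  open import Relation.Nullary using (¬_)
  open import Relation.Nullary.Negation using (contradiction)

  open CommutativeMonoid M
  open import Data.List.Membership.Setoid setoid using (_∈_)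
  open import Data.List.Relation.Unary.Unique.Setoid setoid using (Unique)
  open import Relation.Binary.Reasoning.Setoid setoid

  product : List Carrier → Carrier
  product = foldr _∙_ ε

  product-─ : ∀ {x xs} (x∈xs : x ∈ xs) → product xs ≈ x ∙ product (xs ─ x∈xs)
  product-─ (here x≈y) = ∙-congʳ (sym x≈y)
  product-─ {x} {y ∷ ys} (there x∈ys) = begin
    y ∙ product ys                ≈⟨ ∙-congˡ (product-─ x∈ys) ⟩
    y ∙ (x ∙ product (ys ─ x∈ys)) ≈⟨ sym (assoc y x _) ⟩
    (y ∙ x) ∙ product (ys ─ x∈ys) ≈⟨ ∙-congʳ (comm y x) ⟩
    (x ∙ y) ∙ product (ys ─ x∈ys) ≈⟨ assoc x y _ ⟩
    x ∙ (y ∙ product (ys ─ x∈ys)) ∎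

  ─-⊆ : ∀ {x z xs} (x∈xs : x ∈ xs) → z ∈ (xs ─ x∈xs) → z ∈ xs
  ─-⊆ (here _)     z∈         = there z∈
  ─-⊆ (there x∈xs) (here z≈y) = here z≈y
  ─-⊆ (there x∈xs) (there z∈) = there (─-⊆ x∈xs z∈)

  ─-keeps : ∀ {x z xs} (x∈xs : x ∈ xs) → z ∈ xs → ¬ z ≈ x → z ∈ (xs ─ x∈xs)
  ─-keeps (here x≈y)   (here z≈y) z≉x = contradiction (trans z≈y (sym x≈y)) z≉x
  ─-keeps (here _)     (there z∈) z≉x = z∈
  ─-keeps (there x∈xs) (here z≈y) z≉x = here z≈y
  ─-keeps (there x∈xs) (there z∈) z≉x = there (─-keeps x∈xs z∈ z≉x)

  members-≉ : ∀ {y z xs} → All (λ x → ¬ y ≈ x) xs → z ∈ xs → ¬ z ≈ y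
  members-≉ (y≉x ∷ _)    (here z≈x) z≈y = y≉x (trans (sym z≈y) z≈x)
  members-≉ (_ ∷ y≉xs)  (there z∈)     = members-≉ y≉xs z∈

  ─-drops : ∀ {x z xs} (x∈xs : x ∈ xs) → Unique xs → z ∈ (xs ─ x∈xs) → ¬ z ≈ x
  ─-drops (here x≈y)   (y≉ys ∷ _) z∈         z≈x = members-≉ y≉ys z∈ (trans z≈x x≈y)
  ─-drops (there x∈ys) (y≉ys ∷ _) (here z≈y) z≈x = members-≉ y≉ys x∈ys (trans (sym z≈x) z≈y)
  ─-drops (there x∈ys) (_ ∷ ys!)  (there z∈)     = ─-drops x∈ys ys! z∈

  ─-unique : ∀ {x xs} (x∈xs : x ∈ xs) → Unique xs → Unique (xs ─ x∈xs)
  ─-unique (here _)     (_ ∷ ys!)    = ys!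
  ─-unique (there x∈ys) (y≉ys ∷ ys!) = All.─⁺ x∈ys y≉ys ∷ ─-unique x∈ys ys!

  product-unique : ∀ xs ys → Unique xs → Unique ys → (∀ {z} → z ∈ xs → z ∈ ys) → (∀ {z} → z ∈ ys → z ∈ xs) →
                   product xs ≈ product ys
  product-unique []       []       _ _ _ _ = refl
  product-unique []       (y ∷ ys) _ _ _ ys⊆ with ys⊆ (here refl)
  ... | ()
  product-unique (x ∷ xs) ys (x≉xs ∷ xs!) ys! xs⊆ ys⊆ = begin
    x ∙ product xs          ≈⟨ ∙-congˡ (product-unique xs (ys ─ x∈ys) xs! (─-unique x∈ys ys!) ⊆rest rest⊆) ⟩
    x ∙ product (ys ─ x∈ys) ≈⟨ sym (product-─ x∈ys) ⟩
    product ys              ∎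
    where
    x∈ys : x ∈ ys
    x∈ys = xs⊆ (here refl)
    ⊆rest : ∀ {z} → z ∈ xs → z ∈ (ys ─ x∈ys)
    ⊆rest z∈ = ─-keeps x∈ys (xs⊆ (there z∈)) (members-≉ x≉xs z∈)
    rest⊆ : ∀ {z} → z ∈ (ys ─ x∈ys) → z ∈ xs
    rest⊆ z∈ with ys⊆ (─-⊆ x∈ys z∈)
    ... | here z≈x  = contradiction z≈x (─-drops x∈ys ys! z∈)
    ... | there z∈′ = z∈′

-- Arithmetic of a finite field F with q elements: cancellation, and
-- Fermat's little theorem a^q = a, proved by comparing the product of all
-- nonzero elements with the product of their multiples by a.
module FiniteFields {c ℓ : Level} (F : FiniteField c ℓ) where
  open import Data.Nat as ℕ using (ℕ; zero; suc)
  import Data.Nat.Properties as ℕ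
  open import Data.Integer using (+_)
  open import Data.Product using (_,_; proj₁; proj₂)
  open import Data.List using (List; []; _∷_; length; filter; map)
  open import Data.List.Relation.Unary.All as All using (All; []; _∷_)
  import Data.List.Relation.Unary.All.Properties as All
  open import Data.List.Relation.Unary.Any using (here; there)
  open import Data.List.Relation.Unary.AllPairs as AllPairs using (AllPairs; _∷_)
  import Data.List.Relation.Unary.AllPairs.Properties as AllPairs
  import Data.List.Properties as List
  open import Relation.Nullary using (¬_; Dec; yes; no; ¬?)
  open import Relation.Nullary.Negation using (contradiction)
  import Relation.Binary.PropositionalEquality as P
  open P using (_≡_)

  open FiniteField F
  open ℤSolver commRing using (solve; _:=_; _:-_; _:*_; con)
  open Polynomials commRing using (Separated)
  open Binomials commRing using (InnerBinomialsVanish; inner-binomials-vanish)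
  open UniqueProducts *-commutativeMonoid using (product; product-unique)
  open import Data.List.Membership.Setoid setoid using (_∈_)
  open import Data.List.Membership.Setoid.Properties using (∈-filter⁺; ∈-filter⁻; ∈-map⁺; ∈-map⁻; ∈-resp-≈)
  open import Data.List.Relation.Unary.Unique.Setoid setoid using (Unique)
  open import Algebra.Properties.Semiring.Exp semiring using (_^_)
  open import Algebra.Properties.Group +-group using () renaming (x∙y⁻¹≈ε⇒x≈y to x-y≈0⇒x≈y)
  open import Relation.Binary.Reasoning.Setoid setoid

  cancel : ∀ {x z} → ¬ x ≈ 0# → x * z ≈ 0# → z ≈ 0#
  cancel {x} {z} x≉0 xz≈0 = begin
    z                              ≈⟨ solve 3 (λ x y z → z := y :* (x :* z) :- (x :* y :- con (+ 1)) :* z) refl x y z ⟩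
    y * (x * z) - (x * y - 1#) * z ≈⟨ +-cong (*-congˡ xz≈0) (-‿cong (*-congʳ (+-congʳ (proj₂ (inverse x x≉0))))) ⟩
    y * 0# - (1# - 1#) * z         ≈⟨ solve 2 (λ y z → y :* con (+ 0) :- (con (+ 1) :- con (+ 1)) :* z := con (+ 0)) refl y z ⟩
    0#                             ∎
    where
    y : Carrier
    y = proj₁ (inverse x x≉0)

  *-nonzero : ∀ {x y} → ¬ x ≈ 0# → ¬ y ≈ 0# → ¬ x * y ≈ 0#
  *-nonzero x≉0 y≉0 xy≈0 = y≉0 (cancel x≉0 xy≈0)

  *-cancelˡ : ∀ {a x y} → ¬ a ≈ 0# → a * x ≈ a * y → x ≈ y
  *-cancelˡ {a} {x} {y} a≉0 ax≈ay = x-y≈0⇒x≈y _ _ (cancel a≉0 (begin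
    a * (x - y)    ≈⟨ solve 3 (λ a x y → a :* (x :- y) := a :* x :- a :* y) refl a x y ⟩
    a * x - a * y  ≈⟨ +-congʳ ax≈ay ⟩
    a * y - a * y  ≈⟨ -‿inverseʳ _ ⟩
    0#             ∎))

  elems-separated : AllPairs Separated elems
  elems-separated = AllPairs.map (λ x≉y z e → cancel (λ d≈0 → x≉y (sym (x-y≈0⇒x≈y _ _ d≈0))) e) distinct

  nonzero? : ∀ x → Dec (¬ x ≈ 0#)
  nonzero? x = ¬? (x ≟ 0#)

  units : List Carrier
  units = filter nonzero? elems

  units-nonzero : All (λ x → ¬ x ≈ 0#) units
  units-nonzero = All.all-filter nonzero? elems

  units-unique : Unique units
  units-unique = AllPairs.filter⁺ nonzero? distinct

  ≉0-resp : ∀ {x y} → x ≈ y → ¬ x ≈ 0# → ¬ y ≈ 0#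
  ≉0-resp x≈y x≉0 y≈0 = x≉0 (trans x≈y y≈0)

  unit-member : ∀ {x} → ¬ x ≈ 0# → x ∈ units
  unit-member x≉0 = ∈-filter⁺ setoid nonzero? ≉0-resp (complete _) x≉0

  unit-nonzero : ∀ {x} → x ∈ units → ¬ x ≈ 0#
  unit-nonzero x∈ = proj₂ (∈-filter⁻ setoid nonzero? ≉0-resp {xs = elems} x∈)

  -- q = 1 + |F*|: the element 0 occurs exactly once in the enumeration
  -- (the other elements of the list are ≉ 0 and survive the filter)
  order≡1+|F*| : order ≡ suc (length units)
  order≡1+|F*| = count elems distinct (complete 0#)
    where
    count : ∀ xs → Unique xs → 0# ∈ xs → length xs ≡ suc (length (filter nonzero? xs))
    count (x ∷ xs) (x≉xs ∷ xs!) 0∈ with x ≟ 0# | 0∈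
    ... | no  x≉0 | here 0≈x  = contradiction (sym 0≈x) x≉0
    ... | no  x≉0 | there 0∈′ = P.cong suc (count xs xs! 0∈′)
    ... | yes x≈0 | _         = P.cong suc (P.sym (P.cong length (List.filter-all nonzero? others≉0)))
      where
      others≉0 : All (λ y → ¬ y ≈ 0#) xs
      others≉0 = All.map (λ x≉y y≈0 → x≉y (trans x≈0 (sym y≈0))) x≉xs

  product-nonzero : ∀ xs → All (λ x → ¬ x ≈ 0#) xs → ¬ product xs ≈ 0#
  product-nonzero []       []           1≈0 = 0≉1 (sym 1≈0)
  product-nonzero (x ∷ xs) (x≉0 ∷ xs≉0)     = *-nonzero x≉0 (product-nonzero xs xs≉0)

  product-scaled : ∀ a xs → product (map (a *_) xs) ≈ a ^ length xs * product xs
  product-scaled a []       = sym (*-identityˡ _)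
  product-scaled a (x ∷ xs) = trans (*-congˡ (product-scaled a xs))
    (solve 4 (λ a x p r → a :* x :* (p :* r) := (a :* p) :* (x :* r)) refl a x (a ^ length xs) (product xs))

  -- multiplication by a ≉ 0 permutes F*, so it does not change the product of F*
  product-units-scaled : ∀ a → ¬ a ≈ 0# → product (map (a *_) units) ≈ product units
  product-units-scaled a a≉0 = product-unique aunits units aunits-unique units-unique aunits⊆units units⊆aunits
    where
    aunits : List Carrier
    aunits = map (a *_) units
    aunits-unique : Unique aunits
    aunits-unique = AllPairs.map⁺ (AllPairs.map (λ x≉y ax≈ay → x≉y (*-cancelˡ a≉0 ax≈ay)) units-unique)
    aunits⊆units : ∀ {z} → z ∈ aunits → z ∈ units
    aunits⊆units z∈ with ∈-map⁻ setoid setoid z∈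
    ... | u , u∈ , z≈au = unit-member (≉0-resp (sym z≈au) (*-nonzero a≉0 (unit-nonzero u∈)))
    a⁻¹ : Carrier
    a⁻¹ = proj₁ (inverse a a≉0)
    aa⁻¹≈1 : a * a⁻¹ ≈ 1#
    aa⁻¹≈1 = proj₂ (inverse a a≉0)
    units⊆aunits : ∀ {z} → z ∈ units → z ∈ aunits
    units⊆aunits {z} z∈ = ∈-resp-≈ setoid a[a⁻¹z]≈z (∈-map⁺ setoid setoid *-congˡ (unit-member a⁻¹z≉0))
      where
      a⁻¹z≉0 : ¬ a⁻¹ * z ≈ 0#
      a⁻¹z≉0 = *-nonzero (λ a⁻¹≈0 → 0≉1 (trans (sym (zeroʳ a)) (trans (*-congˡ (sym a⁻¹≈0)) aa⁻¹≈1))) (unit-nonzero z∈)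
      a[a⁻¹z]≈z : a * (a⁻¹ * z) ≈ z
      a[a⁻¹z]≈z = trans (sym (*-assoc a a⁻¹ z)) (trans (*-congʳ aa⁻¹≈1) (*-identityˡ z))

  -- Fermat for units: a^|F*| Π = Π with Π = Π F* ≉ 0
  fermat-unit : ∀ a → ¬ a ≈ 0# → a ^ length units ≈ 1#
  fermat-unit a a≉0 = x-y≈0⇒x≈y _ _ (cancel (product-nonzero units units-nonzero) (begin
    Π * (a ^ n - 1#)   ≈⟨ solve 2 (λ p x → p :* (x :- con (+ 1)) := x :* p :- p) refl Π (a ^ n) ⟩
    a ^ n * Π - Π      ≈⟨ +-congʳ (trans (sym (product-scaled a units)) (product-units-scaled a a≉0)) ⟩
    Π - Π              ≈⟨ -‿inverseʳ Π ⟩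
    0#                 ∎))
    where
    n : ℕ
    n = length units
    Π : Carrier
    Π = product units

  fermat : ∀ a → a ^ suc (length units) ≈ a
  fermat a with a ≟ 0#
  ... | yes a≈0 = trans (*-congʳ a≈0) (trans (zeroˡ _) (sym a≈0))
  ... | no  a≉0 = trans (*-congˡ (fermat-unit a a≉0)) (*-identityʳ a)

  inner-binomials : InnerBinomialsVanish (suc (length units))
  inner-binomials = inner-binomials-vanish (length units) fermat elems
                      (ℕ.≤-reflexive (P.sym order≡1+|F*|)) elems-separated

module QuadraticExtension {c ℓ : Level} (F : FiniteField c ℓ) (t0 t1 : FiniteField.Carrier F) where
  open import Data.Integer using (+_)
  open import Data.Product using (_,_; proj₁; proj₂)
  open import Relation.Nullary using (¬_; yes; no)
  open import Relation.Nullary.Negation using (contradiction)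

  open FiniteField F
  open BruckBose F t0 t1
  open ℤSolver commRing using (solve; _:=_; _:+_; _:-_; _:*_; :-_; con)

  Ering : CommutativeRing c ℓ
  Ering = record
    { Carrier = E ; _≈_ = _≈E_ ; _+_ = _+E_ ; _*_ = _*E_ ; -_ = -E_ ; 0# = 0E ; 1# = 1E
    ; isCommutativeRing = record
      { isRing = record
        { +-isAbelianGroup = record
          { isGroup = record
            { isMonoid = record
              { isSemigroup = record
                { isMagma = record
                  { isEquivalence = record { refl = refl , refl ; sym = λ (p , q) → sym p , sym q
                                           ; trans = λ (p , q) (p′ , q′) → trans p p′ , trans q q′ }
                  ; ∙-cong = λ (p , q) (p′ , q′) → +-cong p p′ , +-cong q q′ }
                ; assoc = λ (a , b) (c , d) (e , f) → +-assoc a c e , +-assoc b d f }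
              ; identity = (λ (a , b) → +-identityˡ a , +-identityˡ b) , (λ (a , b) → +-identityʳ a , +-identityʳ b) }
            ; inverse = (λ (a , b) → -‿inverseˡ a , -‿inverseˡ b) , (λ (a , b) → -‿inverseʳ a , -‿inverseʳ b)
            ; ⁻¹-cong = λ (p , q) → -‿cong p , -‿cong q }
          ; comm = λ (a , b) (c , d) → +-comm a c , +-comm b d }
        ; *-cong = λ (p , q) (p′ , q′) → +-cong (*-cong p p′) (*-congʳ (*-cong q q′))
                                       , +-cong (+-cong (*-cong p q′) (*-cong q p′)) (*-congʳ (*-cong q q′))
        ; *-assoc = *E-assoc
        ; *-identity = *E-identityˡ , *E-identityʳ
        ; distrib = *E-distribˡ , *E-distribʳ }
      ; *-comm = *E-comm } }
    where
    *E-assoc : ∀ x y z → ((x *E y) *E z) ≈E (x *E (y *E z))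
    *E-assoc (a , b) (c , d) (e , f) =
      solve 8 (λ a b c d e f t₀ t₁ → (a :* c :+ b :* d :* t₀) :* e :+ ((a :* d :+ b :* c) :+ b :* d :* t₁) :* f :* t₀
                                  := a :* (c :* e :+ d :* f :* t₀) :+ b :* ((c :* f :+ d :* e) :+ d :* f :* t₁) :* t₀)
        refl a b c d e f t0 t1 ,
      solve 8 (λ a b c d e f t₀ t₁ → ((a :* c :+ b :* d :* t₀) :* f :+ ((a :* d :+ b :* c) :+ b :* d :* t₁) :* e)
                                       :+ ((a :* d :+ b :* c) :+ b :* d :* t₁) :* f :* t₁
                                  := (a :* ((c :* f :+ d :* e) :+ d :* f :* t₁) :+ b :* (c :* e :+ d :* f :* t₀))
                                       :+ b :* ((c :* f :+ d :* e) :+ d :* f :* t₁) :* t₁)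
        refl a b c d e f t0 t1
    *E-comm : ∀ x y → (x *E y) ≈E (y *E x)
    *E-comm (a , b) (c , d) =
      solve 5 (λ a b c d t₀ → a :* c :+ b :* d :* t₀ := c :* a :+ d :* b :* t₀) refl a b c d t0 ,
      solve 5 (λ a b c d t₁ → (a :* d :+ b :* c) :+ b :* d :* t₁ := (c :* b :+ d :* a) :+ d :* b :* t₁) refl a b c d t1
    *E-identityˡ : ∀ x → (1E *E x) ≈E x
    *E-identityˡ (a , b) =
      solve 3 (λ a b t₀ → con (+ 1) :* a :+ con (+ 0) :* b :* t₀ := a) refl a b t0 ,
      solve 3 (λ a b t₁ → (con (+ 1) :* b :+ con (+ 0) :* a) :+ con (+ 0) :* b :* t₁ := b) refl a b t1
    *E-identityʳ : ∀ x → (x *E 1E) ≈E x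
    *E-identityʳ (a , b) =
      solve 3 (λ a b t₀ → a :* con (+ 1) :+ b :* con (+ 0) :* t₀ := a) refl a b t0 ,
      solve 3 (λ a b t₁ → (a :* con (+ 0) :+ b :* con (+ 1)) :+ b :* con (+ 0) :* t₁ := b) refl a b t1
    *E-distribˡ : ∀ x y z → (x *E (y +E z)) ≈E ((x *E y) +E (x *E z))
    *E-distribˡ (a , b) (c , d) (e , f) =
      solve 7 (λ a b c d e f t₀ → a :* (c :+ e) :+ b :* (d :+ f) :* t₀ := (a :* c :+ b :* d :* t₀) :+ (a :* e :+ b :* f :* t₀))
        refl a b c d e f t0 ,
      solve 7 (λ a b c d e f t₁ → (a :* (d :+ f) :+ b :* (c :+ e)) :+ b :* (d :+ f) :* t₁
                                := ((a :* d :+ b :* c) :+ b :* d :* t₁) :+ ((a :* f :+ b :* e) :+ b :* f :* t₁))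
        refl a b c d e f t1
    *E-distribʳ : ∀ x y z → ((y +E z) *E x) ≈E ((y *E x) +E (z *E x))
    *E-distribʳ (a , b) (c , d) (e , f) =
      solve 7 (λ a b c d e f t₀ → (c :+ e) :* a :+ (d :+ f) :* b :* t₀ := (c :* a :+ d :* b :* t₀) :+ (e :* a :+ f :* b :* t₀))
        refl a b c d e f t0 ,
      solve 7 (λ a b c d e f t₁ → ((c :+ e) :* b :+ (d :+ f) :* a) :+ (d :+ f) :* b :* t₁
                                := ((c :* b :+ d :* a) :+ d :* b :* t₁) :+ ((e :* b :+ f :* a) :+ f :* b :* t₁))
        refl a b c d e f t1

  module ER = CommutativeRing Ering
  module ES = ℤSolver Ering

  τ̄ : E
  τ̄ = (t1 , - 1#)

  conj : E → E
  conj (a , b) = (a + b * t1 , - b)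

  conj-+ : ∀ x y → conj (x +E y) ≈E (conj x +E conj y)
  conj-+ (a , b) (c , d) =
    solve 5 (λ a b c d t₁ → (a :+ c) :+ (b :+ d) :* t₁ := (a :+ b :* t₁) :+ (c :+ d :* t₁)) refl a b c d t1 ,
    solve 2 (λ b d → :- (b :+ d) := :- b :+ :- d) refl b d

  conj-* : ∀ x y → conj (x *E y) ≈E (conj x *E conj y)
  conj-* (a , b) (c , d) =
    solve 6 (λ a b c d t₀ t₁ → (a :* c :+ b :* d :* t₀) :+ ((a :* d :+ b :* c) :+ b :* d :* t₁) :* t₁
                             := (a :+ b :* t₁) :* (c :+ d :* t₁) :+ (:- b) :* (:- d) :* t₀) refl a b c d t0 t1 ,
    solve 5 (λ a b c d t₁ → :- ((a :* d :+ b :* c) :+ b :* d :* t₁)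
                          := ((a :+ b :* t₁) :* (:- d) :+ (:- b) :* (c :+ d :* t₁)) :+ (:- b) :* (:- d) :* t₁) refl a b c d t1

  conj-0 : conj 0E ≈E 0E
  conj-0 = solve 1 (λ t₁ → con (+ 0) :+ con (+ 0) :* t₁ := con (+ 0)) refl t1 , solve 0 (:- con (+ 0) := con (+ 0)) refl

  conj-1 : conj 1E ≈E 1E
  conj-1 = solve 1 (λ t₁ → con (+ 1) :+ con (+ 0) :* t₁ := con (+ 1)) refl t1 , solve 0 (:- con (+ 0) := con (+ 0)) refl

  conj-τ : conj τE ≈E τ̄
  conj-τ = solve 1 (λ t₁ → con (+ 0) :+ con (+ 1) :* t₁ := t₁) refl t1 , refl

  -- τ̄ ∉ F: the elements 1 - sτ̄ (s ∈ F) and -τ̄ are nonzero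
  1-sτ̄≉0 : ∀ s → ¬ (1E ER.- (emb s *E τ̄)) ≈E 0E
  1-sτ̄≉0 s (e₁ , e₂) = 0≉1 (sym 1≈0)
    where
    s≈0 : s ≈ 0#
    s≈0 = trans (solve 2 (λ s t₁ → s := con (+ 0) :+ :- ((s :* (:- con (+ 1)) :+ con (+ 0) :* t₁) :+ con (+ 0) :* (:- con (+ 1)) :* t₁))
                  refl s t1) e₂
    1≈0 : 1# ≈ 0#
    1≈0 = trans (solve 3 (λ s t₀ t₁ → con (+ 1) := (con (+ 1) :+ :- (s :* t₁ :+ con (+ 0) :* (:- con (+ 1)) :* t₀)) :+ s :* t₁)
                   refl s t0 t1)
          (trans (+-cong e₁ (*-congʳ s≈0)) (solve 1 (λ t₁ → con (+ 0) :+ con (+ 0) :* t₁ := con (+ 0)) refl t1))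

  -τ̄≉0 : ¬ (ER.- τ̄) ≈E 0E
  -τ̄≉0 (_ , e₂) = 0≉1 (sym (trans (solve 0 (con (+ 1) := :- (:- con (+ 1))) refl) e₂))

  -- the norm z z̄ ∈ F
  norm : E → Carrier
  norm (a , b) = a * a + t1 * a * b - t0 * b * b

  z*conj-z : ∀ z → (z *E conj z) ≈E emb (norm z)
  z*conj-z (a , b) =
    solve 4 (λ a b t₀ t₁ → a :* (a :+ b :* t₁) :+ b :* (:- b) :* t₀ := a :* a :+ t₁ :* a :* b :- t₀ :* b :* b) refl a b t0 t1 ,
    solve 3 (λ a b t₁ → (a :* (:- b) :+ b :* (a :+ b :* t₁)) :+ b :* (:- b) :* t₁ := con (+ 0)) refl a b t1

  emb-* : ∀ s z → (emb s *E z) ≈E (s * proj₁ z , s * proj₂ z)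
  emb-* s (a , b) =
    solve 4 (λ s a b t₀ → s :* a :+ con (+ 0) :* b :* t₀ := s :* a) refl s a b t0 ,
    solve 4 (λ s a b t₁ → (s :* b :+ con (+ 0) :* a) :+ con (+ 0) :* b :* t₁ := s :* b) refl s a b t1

  emb-+ : ∀ x y → emb (x + y) ≈E (emb x +E emb y)
  emb-+ x y = refl , sym (+-identityʳ 0#)

  emb-*E : ∀ x y → emb (x * y) ≈E (emb x *E emb y)
  emb-*E x y = ER.sym (ER.trans (emb-* x (emb y)) (refl , zeroʳ x))

  decomposition : ∀ u → u ≈E (emb (proj₁ u) +E (emb (proj₂ u) *E τE))
  decomposition (a , b) =
    solve 3 (λ a b t₀ → a := a :+ (b :* con (+ 0) :+ con (+ 0) :* con (+ 1) :* t₀)) refl a b t0 ,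
    solve 2 (λ b t₁ → b := con (+ 0) :+ ((b :* con (+ 1) :+ con (+ 0) :* con (+ 0)) :+ con (+ 0) :* con (+ 1) :* t₁)) refl b t1

  conj-decomposition : ∀ u → conj u ≈E (emb (proj₁ u) +E (emb (proj₂ u) *E τ̄))
  conj-decomposition (a , b) =
    solve 4 (λ a b t₀ t₁ → a :+ b :* t₁ := a :+ (b :* t₁ :+ con (+ 0) :* (:- con (+ 1)) :* t₀)) refl a b t0 t1 ,
    solve 2 (λ b t₁ → :- b := con (+ 0) :+ ((b :* (:- con (+ 1)) :+ con (+ 0) :* t₁) :+ con (+ 0) :* (:- con (+ 1)) :* t₁)) refl b t1

  open import Algebra.Properties.Group +-group using () renaming (x∙y⁻¹≈ε⇒x≈y to x-y≈0⇒x≈y)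
  open FiniteFields F using (cancel; *-nonzero)

  -- when x² - t₁x - t₀ has no root in F, only 0 has norm 0: if b ≉ 0 and
  -- a² + t₁ab - t₀b² = 0, then r = -a/b is a root
  norm≈0⇒≈0 : Irreducible → ∀ z → norm z ≈ 0# → z ≈E 0E
  norm≈0⇒≈0 irr (a , b) N≈0 with b ≟ 0#
  ... | yes b≈0 = a≈0 , b≈0
    where
    open import Relation.Binary.Reasoning.Setoid setoid
    a²≈0 : a * a ≈ 0#
    a²≈0 = begin
      a * a                                ≈⟨ solve 4 (λ a b t₀ t₁ → a :* a := (a :* a :+ t₁ :* a :* b :- t₀ :* b :* b) :- b :* (t₁ :* a :- t₀ :* b))
                                                refl a b t0 t1 ⟩
      norm (a , b) - b * (t1 * a - t0 * b) ≈⟨ +-cong N≈0 (-‿cong (*-congʳ b≈0)) ⟩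
      0# - 0# * (t1 * a - t0 * b)          ≈⟨ solve 1 (λ u → con (+ 0) :- con (+ 0) :* u := con (+ 0)) refl _ ⟩
      0#                                   ∎
    a≈0 : a ≈ 0#
    a≈0 with a ≟ 0#
    ... | yes a≈0 = a≈0
    ... | no  a≉0 = contradiction a²≈0 (*-nonzero a≉0 a≉0)
  ... | no b≉0 = contradiction r-root (irr r)
    where
    open import Relation.Binary.Reasoning.Setoid setoid
    i : Carrier
    i = proj₁ (inverse b b≉0)
    bi≈1 : b * i ≈ 1#
    bi≈1 = proj₂ (inverse b b≉0)
    r : Carrier
    r = - (a * i)
    r-root : r * r ≈ t1 * r + t0
    r-root = x-y≈0⇒x≈y _ _ (begin
      r * r - (t1 * r + t0)         ≈⟨ solve 5 (λ a b i t₀ t₁ →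
             (:- (a :* i)) :* (:- (a :* i)) :- (t₁ :* (:- (a :* i)) :+ t₀)
          := (a :* a :+ t₁ :* a :* b :- t₀ :* b :* b) :* i :* i :- (t₁ :* a :* i :- t₀ :* (b :* i :+ con (+ 1))) :* (b :* i :- con (+ 1)))
          refl a b i t0 t1 ⟩
      N * i * i - u * (b * i - 1#)  ≈⟨ +-cong (*-congʳ (*-congʳ N≈0)) (-‿cong (*-congˡ (+-congʳ bi≈1))) ⟩
      0# * i * i - u * (1# - 1#)    ≈⟨ solve 2 (λ i u → con (+ 0) :* i :* i :- u :* (con (+ 1) :- con (+ 1)) := con (+ 0)) refl i u ⟩
      0#                            ∎)
      where
      N u : Carrier
      N = norm (a , b)
      u = t1 * a * i - t0 * (b * i + 1#)

  -- ... and then E has no zero divisors: ū u v = N(u) v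
  no-zero-divisors : Irreducible → ∀ u v → (u *E v) ≈E 0E → ¬ u ≈E 0E → v ≈E 0E
  no-zero-divisors irr u v uv≈0 u≉0 = cancel N≉0 (proj₁ Nv≈0) , cancel N≉0 (proj₂ Nv≈0)
    where
    N≉0 : ¬ norm u ≈ 0#
    N≉0 N≈0 = u≉0 (norm≈0⇒≈0 irr u N≈0)
    Nv≈0 : (norm u * proj₁ v , norm u * proj₂ v) ≈E 0E
    Nv≈0 = ER.trans (ER.sym (emb-* (norm u) v)) (ER.trans (ER.*-congʳ (ER.sym (z*conj-z u)))
             (ER.trans (ES.solve 3 (λ u ū v → (u ES.:* ū) ES.:* v ES.:= ū ES.:* (u ES.:* v)) ER.refl u (conj u) v)
             (ER.trans (ER.*-congˡ uv≈0) (ER.zeroʳ (conj u)))))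

-- The Frobenius map x ↦ x^q of E (q = |F| = 1 + m): it is additive and fixes F,
-- so it sends the root τ of x² - t₁x - t₀ to a root w of the same polynomial;
-- w ≉ τ because x^q - x has at most q roots, hence w = τ̄.
module Frobenius {c ℓ : Level} (F : FiniteField c ℓ) (t0 t1 : FiniteField.Carrier F) where
  open import Data.Nat as ℕ using (ℕ; zero; suc; z≤n; s≤s)
  open import Data.Nat.Combinatorics using (_C_)
  import Data.Nat.Properties as ℕ
  open import Data.Integer using (+_)
  open import Data.Product using (_,_; proj₁; proj₂)
  open import Data.List using (List; _∷_; length; map)
  open import Data.List.Relation.Unary.All as All using (All; _∷_)
  import Data.List.Relation.Unary.All.Properties as All
  open import Data.List.Relation.Unary.Any using (Any; here; there)
  open import Data.List.Relation.Unary.AllPairs as AllPairs using (AllPairs; _∷_)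
  import Data.List.Relation.Unary.AllPairs.Properties as AllPairs
  import Data.List.Properties as List
  open import Relation.Nullary using (¬_; yes; no)
  open import Relation.Nullary.Negation using (contradiction)
  import Relation.Binary.PropositionalEquality as P
  open P using (_≡_)

  open FiniteField F
  open BruckBose F t0 t1
  open QuadraticExtension F t0 t1
  open ℤSolver commRing using (solve; _:=_; _:+_; _:-_; _:*_; :-_; con)
  open FiniteFields F using (units; order≡1+|F*|; unit-member; fermat; inner-binomials)
  open import Algebra.Properties.Group +-group using () renaming (x∙y⁻¹≈ε⇒x≈y to x-y≈0⇒x≈y)
  open import Algebra.Properties.Group ER.+-group using () renaming (x∙y⁻¹≈ε⇒x≈y to x-y≈0⇒x≈yE)
  open import Algebra.Properties.Semiring.Exp semiring using (_^_)
  open import Algebra.Properties.Semiring.Exp ER.semiring using (^-congˡ) renaming (_^_ to _^ᴱ_)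
  open import Algebra.Properties.CommutativeSemiring.Exp ER.commutativeSemiring using (^-distrib-*)
  open import Algebra.Properties.Semiring.Mult semiring using (_×_)
  open import Algebra.Properties.Semiring.Mult ER.semiring using () renaming (_×_ to _×ᴱ_)
  open Binomials Ering using (frobenius-additive)
  open Polynomials Ering using (power-roots) renaming (Separated to SeparatedE)

  m : ℕ
  m = length units

  -- integer multiples of 1 in E lie in F, so the inner binomials vanish in E too
  ×-1E : ∀ k → (k ×ᴱ 1E) ≈E emb (k × 1#)
  ×-1E zero    = ER.refl
  ×-1E (suc k) = +-congˡ (proj₁ (×-1E k)) , trans (+-congˡ (proj₂ (×-1E k))) (+-identityˡ 0#)

  frobenius-additiveE : ∀ x y → ((x +E y) ^ᴱ suc m) ≈E ((x ^ᴱ suc m) +E (y ^ᴱ suc m))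
  frobenius-additiveE = frobenius-additive m (λ j 0<j j<q → ER.trans (×-1E (suc m C j)) (inner-binomials j 0<j j<q , refl))

  emb-^ : ∀ a k → (emb a ^ᴱ k) ≈E emb (a ^ k)
  emb-^ a zero    = ER.refl
  emb-^ a (suc k) = ER.trans (ER.*-congˡ (emb-^ a k)) (ER.trans (emb-* a (emb (a ^ k))) (refl , zeroʳ a))

  emb-fixed : ∀ a → (emb a ^ᴱ suc m) ≈E emb a
  emb-fixed a = ER.trans (emb-^ a (suc m)) (fermat a , refl)

  τ-root : (τE *E τE) ≈E ((emb t1 *E τE) +E emb t0)
  τ-root = solve 2 (λ t₀ t₁ → con (+ 0) :* con (+ 0) :+ con (+ 1) :* con (+ 1) :* t₀
                           := (t₁ :* con (+ 0) :+ con (+ 0) :* con (+ 1) :* t₀) :+ t₀) refl t0 t1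
             ,
           solve 1 (λ t₁ → (con (+ 0) :* con (+ 1) :+ con (+ 1) :* con (+ 0)) :+ con (+ 1) :* con (+ 1) :* t₁
                        := ((t₁ :* con (+ 1) :+ con (+ 0) :* con (+ 0)) :+ con (+ 0) :* con (+ 1) :* t₁) :+ con (+ 0)) refl t1

  w : E
  w = τE ^ᴱ suc m

  w-root : (w *E w) ≈E ((emb t1 *E w) +E emb t0)
  w-root = begin
    w *E w                                         ≈⟨ ER.sym (^-distrib-* τE τE (suc m)) ⟩
    (τE *E τE) ^ᴱ suc m                            ≈⟨ ^-congˡ (suc m) τ-root ⟩
    ((emb t1 *E τE) +E emb t0) ^ᴱ suc m            ≈⟨ frobenius-additiveE _ _ ⟩
    ((emb t1 *E τE) ^ᴱ suc m) +E (emb t0 ^ᴱ suc m) ≈⟨ ER.+-cong (^-distrib-* (emb t1) τE (suc m)) (emb-fixed t0) ⟩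
    ((emb t1 ^ᴱ suc m) *E w) +E emb t0             ≈⟨ ER.+-congʳ (ER.*-congʳ (emb-fixed t1)) ⟩
    (emb t1 *E w) +E emb t0                        ∎
    where open import Relation.Binary.Reasoning.Setoid ER.setoid

  -- the two roots are τ and τ̄ = t₁ - τ
  w-τ-τ̄ : ((w ER.- τE) *E (w ER.- τ̄)) ≈E 0E
  w-τ-τ̄ = begin
    (w ER.- τE) *E (w ER.- τ̄)                        ≈⟨ ER.*-congˡ (ER.+-congˡ (ER.-‿cong τ̄≈t₁-τ)) ⟩
    (w ER.- τE) *E (w ER.- (emb t1 ER.- τE))          ≈⟨ ES.solve 4 (λ w τ T₁ T₀ →
         (w ES.:- τ) ES.:* (w ES.:- (T₁ ES.:- τ))
      ES.:= (w ES.:* w ES.:- (T₁ ES.:* w ES.:+ T₀)) ES.:- (τ ES.:* τ ES.:- (T₁ ES.:* τ ES.:+ T₀))) ER.refl w τE (emb t1) (emb t0) ⟩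
    ((w *E w) ER.- ((emb t1 *E w) +E emb t0)) ER.- ((τE *E τE) ER.- ((emb t1 *E τE) +E emb t0))
                                                      ≈⟨ ER.+-cong (ER.trans (ER.+-congʳ w-root) (ER.-‿inverseʳ _))
                                                                   (ER.-‿cong (ER.trans (ER.+-congʳ τ-root) (ER.-‿inverseʳ _))) ⟩
    0E ER.- 0E                                        ≈⟨ ER.-‿inverseʳ 0E ⟩
    0E                                                ∎
    where
    open import Relation.Binary.Reasoning.Setoid ER.setoid
    τ̄≈t₁-τ : τ̄ ≈E (emb t1 ER.- τE)
    τ̄≈t₁-τ = solve 1 (λ t₁ → t₁ := t₁ :- con (+ 0)) refl t1 , solve 0 (:- con (+ 1) := con (+ 0) :- con (+ 1)) refl

  -- w ≉ τ: otherwise x^q - x would have the q + 1 pairwise separated roots τ and F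
  w≉τ : Irreducible → ¬ w ≈E τE
  w≉τ irr w≈τ = 0≉1 (sym (proj₁ 1≈0))
    where
    roots : List E
    roots = τE ∷ map emb elems
    2≤q : 2 ℕ.≤ suc m
    2≤q = s≤s (nonempty (unit-member (λ 1≈0 → 0≉1 (sym 1≈0))))
      where
      nonempty : ∀ {x xs} → Any (x ≈_) xs → 1 ℕ.≤ length xs
      nonempty (here _)  = s≤s z≤n
      nonempty (there _) = s≤s z≤n
    enough : suc (suc m) ℕ.≤ length roots
    enough = ℕ.≤-reflexive (P.cong suc (P.trans (P.sym order≡1+|F*|) (P.sym (List.length-map emb elems))))
    τ-separated : ∀ a → SeparatedE τE (emb a)
    τ-separated a z h = no-zero-divisors irr _ z h (λ d≈0 → 0≉1 (sym (begin
      1#                ≈⟨ solve 0 (con (+ 1) := :- (con (+ 0) :+ :- con (+ 1))) refl ⟩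
      - (0# + - 1#)     ≈⟨ -‿cong (proj₂ d≈0) ⟩
      - 0#              ≈⟨ solve 0 (:- con (+ 0) := con (+ 0)) refl ⟩
      0#                ∎)))
      where open import Relation.Binary.Reasoning.Setoid setoid
    F-separated : AllPairs SeparatedE (map emb elems)
    F-separated = AllPairs.map⁺ (AllPairs.map (λ a≉b z h → no-zero-divisors irr _ z h
                    (λ d≈0 → a≉b (sym (x-y≈0⇒x≈y _ _ (proj₁ d≈0))))) distinct)
    fixed : All (λ c → (c ^ᴱ suc m) ≈E c) roots
    fixed = w≈τ ∷ All.map⁺ (All.universal emb-fixed elems)
    1≈0 : 1E ≈E 0E
    1≈0 = power-roots (suc m) 2≤q roots enough (All.map⁺ (All.universal τ-separated elems) ∷ F-separated) fixed

  w≈τ̄ : Irreducible → w ≈E τ̄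
  w≈τ̄ irr with (w ER.- τE) ≟E 0E
  ... | yes w-τ≈0 = contradiction (x-y≈0⇒x≈yE _ _ w-τ≈0) (w≉τ irr)
  ... | no  w-τ≉0 = x-y≈0⇒x≈yE _ _ (no-zero-divisors irr (w ER.- τE) (w ER.- τ̄) w-τ-τ̄ w-τ≉0)

  frob-τ : Irreducible → frob τE ≈E τ̄
  frob-τ irr = P.subst (_≈E τ̄) (P.sym frob≡w) (w≈τ̄ irr)
    where
    ^E≡^ᴱ : ∀ k x → (x ^E k) ≡ (x ^ᴱ k)
    ^E≡^ᴱ zero    x = P.refl
    ^E≡^ᴱ (suc k) x = P.cong (x *E_) (^E≡^ᴱ k x)
    frob≡w : frob τE ≡ w
    frob≡w = P.trans (^E≡^ᴱ order τE) (P.cong (τE ^ᴱ_) order≡1+|F*|)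

module QuadraticForms {c ℓ : Level} (F : FiniteField c ℓ) (t0 t1 : FiniteField.Carrier F) where
  open import Data.Nat using (zero; suc)
  open import Data.Integer using (+_)
  open import Data.Fin using (Fin) renaming (zero to fzero; suc to fsuc)
  open import Data.Product using (_,_; proj₁; proj₂)
  open import Data.Maybe using (Maybe; just; nothing)
  import Relation.Binary.PropositionalEquality as P
  open P using (_≡_)

  open FiniteField F
  open BruckBose F t0 t1
  open QuadraticExtension F t0 t1
    using (Ering; module ER; module ES; τ̄; conj; conj-+; conj-*; emb-+; emb-*E; decomposition; conj-decomposition)
  open ES using (solve; _:=_; _:+_; _:-_; _:*_; :-_; con)
  open import Relation.Binary.Reasoning.Setoid ER.setoid

  sum-cong : ∀ n {f g : Fin n → E} → (∀ i → f i ≈E g i) → sumFin n f ≈E sumFin n g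
  sum-cong zero    f≈g = ER.refl
  sum-cong (suc n) f≈g = ER.+-cong (f≈g fzero) (sum-cong n (λ i → f≈g (fsuc i)))

  sum-+ : ∀ n (f g : Fin n → E) → sumFin n (λ i → f i +E g i) ≈E (sumFin n f +E sumFin n g)
  sum-+ zero    f g = ER.sym (ER.+-identityʳ 0E)
  sum-+ (suc n) f g = ER.trans (ER.+-congˡ (sum-+ n (λ i → f (fsuc i)) (λ i → g (fsuc i))))
    (solve 4 (λ a b c d → (a :+ b) :+ (c :+ d) := (a :+ c) :+ (b :+ d)) ER.refl
       (f fzero) (g fzero) (sumFin n (λ i → f (fsuc i))) (sumFin n (λ i → g (fsuc i))))

  sum-scale : ∀ n s (f : Fin n → E) → sumFin n (λ i → s *E f i) ≈E (s *E sumFin n f)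
  sum-scale zero    s f = ER.sym (ER.zeroʳ s)
  sum-scale (suc n) s f = ER.trans (ER.+-congˡ (sum-scale n s (λ i → f (fsuc i)))) (ER.sym (ER.distribˡ s _ _))

  form : (Fin 5 → E) → (Fin 5 → E) → E
  form L v = sumFin 5 λ i → L i *E v i

  value : QF5 → (Fin 5 → E) → E
  value C v = sumFin 5 λ i → sumFin 5 λ j → (C i j *E v i) *E v j

  form-cong : ∀ L {v v′} → (∀ i → v i ≈E v′ i) → form L v ≈E form L v′
  form-cong L v≈v′ = sum-cong 5 (λ i → ER.*-congˡ {L i} (v≈v′ i))

  value-cong : ∀ {C D} v → (∀ i j → C i j ≈E D i j) → value C v ≈E value D v
  value-cong v C≈D = sum-cong 5 (λ i → sum-cong 5 (λ j → ER.*-congʳ {v j} (ER.*-congʳ {v i} (C≈D i j))))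

  value-+ : ∀ C D v → value (C +Q D) v ≈E (value C v +E value D v)
  value-+ C D v = ER.trans (sum-cong 5 (λ i → ER.trans (sum-cong 5 (λ j → expand i j)) (sum-+ 5 (term C i) (term D i))))
                    (sum-+ 5 (λ i → sumFin 5 (term C i)) (λ i → sumFin 5 (term D i)))
    where
    term : QF5 → Fin 5 → Fin 5 → E
    term X i j = (X i j *E v i) *E v j
    expand : ∀ i j → (((C i j +E D i j) *E v i) *E v j) ≈E (((C i j *E v i) *E v j) +E ((D i j *E v i) *E v j))
    expand i j = solve 4 (λ c d x y → (c :+ d) :* x :* y := c :* x :* y :+ d :* x :* y)
                   ER.refl (C i j) (D i j) (v i) (v j)

  value-scale : ∀ s C v → value (s ·Q C) v ≈E (s *E value C v)
  value-scale s C v = ER.trans (sum-cong 5 (λ i → ER.trans (sum-cong 5 (λ j → expand i j)) (sum-scale 5 s (term i))))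
                        (sum-scale 5 s (λ i → sumFin 5 (term i)))
    where
    term : Fin 5 → Fin 5 → E
    term i j = (C i j *E v i) *E v j
    expand : ∀ i j → (((s *E C i j) *E v i) *E v j) ≈E (s *E ((C i j *E v i) *E v j))
    expand i j = solve 4 (λ s c x y → s :* c :* x :* y := s :* (c :* x :* y)) ER.refl s (C i j) (v i) (v j)

  value-⊗ : ∀ L M v → value (L ⊗ M) v ≈E (form L v *E form M v)
  value-⊗ L M v = begin
    value (L ⊗ M) v                                  ≈⟨ sum-cong 5 (λ i → ER.trans (sum-cong 5 (regroup i)) (sum-scale 5 (L i *E v i) (λ j → M j *E v j))) ⟩
    sumFin 5 (λ i → (L i *E v i) *E form M v)        ≈⟨ sum-cong 5 (λ i → ER.*-comm (L i *E v i) (form M v)) ⟩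
    sumFin 5 (λ i → form M v *E (L i *E v i))        ≈⟨ sum-scale 5 (form M v) (λ i → L i *E v i) ⟩
    form M v *E form L v                             ≈⟨ ER.*-comm (form M v) (form L v) ⟩
    form L v *E form M v                             ∎
    where
    regroup : ∀ i j → (((L i *E M j) *E v i) *E v j) ≈E ((L i *E v i) *E (M j *E v j))
    regroup i j = solve 4 (λ l m x y → l :* m :* x :* y := (l :* x) :* (m :* y)) ER.refl (L i) (M j) (v i) (v j)

  substitute : Conic → (Fin 5 → E) → (Fin 5 → E) → (Fin 5 → E) → QF5
  substitute O L M N =
    (((((ca ·Q (L ⊗ L)) +Q (cb ·Q (M ⊗ M))) +Q (cc ·Q (N ⊗ N)))
      +Q (cd ·Q (L ⊗ M))) +Q (ce ·Q (L ⊗ N))) +Q (ch ·Q (M ⊗ N))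
    where open Conic O

  value-term : ∀ s L M v → value (s ·Q (L ⊗ M)) v ≈E (s *E (form L v *E form M v))
  value-term s L M v = ER.trans (value-scale s (L ⊗ M) v) (ER.*-congˡ {s} (value-⊗ L M v))

  value-substitute : ∀ O L M N v → value (substitute O L M N) v ≈E evalConic O (form L v) (form M v) (form N v)
  value-substitute O L M N v =
    ER.trans (value-+ T₅ (ch ·Q (M ⊗ N)) v) (ER.+-cong
    (ER.trans (value-+ T₄ (ce ·Q (L ⊗ N)) v) (ER.+-cong
    (ER.trans (value-+ T₃ (cd ·Q (L ⊗ M)) v) (ER.+-cong
    (ER.trans (value-+ T₂ (cc ·Q (N ⊗ N)) v) (ER.+-cong
    (ER.trans (value-+ T₁ (cb ·Q (M ⊗ M)) v) (ER.+-cong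
      (value-term ca L L v) (value-term cb M M v)))
      (value-term cc N N v)))
      (value-term cd L M v)))
      (value-term ce L N v)))
      (value-term ch M N v))
    where
    open Conic O
    T₁ T₂ T₃ T₄ T₅ : QF5
    T₁ = ca ·Q (L ⊗ L)
    T₂ = T₁ +Q (cb ·Q (M ⊗ M))
    T₃ = T₂ +Q (cc ·Q (N ⊗ N))
    T₄ = T₃ +Q (cd ·Q (L ⊗ M))
    T₅ = T₄ +Q (ce ·Q (L ⊗ N))

  conjugate : Conic → Conic
  conjugate O = record { ca = conj ca ; cb = conj cb ; cc = conj cc ; cd = conj cd ; ce = conj ce ; ch = conj ch }
    where open Conic O

  conj-substitute : ∀ O L M N i j →
    conj (substitute O L M N i j) ≈E substitute (conjugate O) (λ k → conj (L k)) (λ k → conj (M k)) (λ k → conj (N k)) i j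
  conj-substitute O L M N i j =
    ER.trans (conj-+ _ _) (ER.+-cong
    (ER.trans (conj-+ _ _) (ER.+-cong
    (ER.trans (conj-+ _ _) (ER.+-cong
    (ER.trans (conj-+ _ _) (ER.+-cong
    (ER.trans (conj-+ _ _) (ER.+-cong
      (conj-term ca (L i) (L j)) (conj-term cb (M i) (M j))))
      (conj-term cc (N i) (N j))))
      (conj-term cd (L i) (M j))))
      (conj-term ce (L i) (N j))))
      (conj-term ch (M i) (N j)))
    where
    open Conic O
    conj-term : ∀ s x y → conj (s *E (x *E y)) ≈E (conj s *E (conj x *E conj y))
    conj-term s x y = ER.trans (conj-* s (x *E y)) (ER.*-congˡ {conj s} (conj-* x y))

  δ : E
  δ = τE ER.- τ̄

  pencilCoefficient : Maybe Carrier → E → Carrier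
  pencilCoefficient (just s) u = (s * proj₁ u) + proj₂ u
  pencilCoefficient nothing  u = proj₁ u

  α β : Maybe Carrier → E
  α (just s) = (emb s *E τE) ER.- 1E
  α nothing  = τE
  β (just s) = 1E ER.- (emb s *E τ̄)
  β nothing  = ER.- τ̄

  -- (τ - τ̄)(t u∞ + u₀) = α_t ū + β_t u: the pencil is a combination of f and f̄
  pencil-split : ∀ t u → (δ *E emb (pencilCoefficient t u)) ≈E ((α t *E conj u) +E (β t *E u))
  pencil-split (just s) u@(a , b) = begin
    δ *E emb ((s * a) + b)                                      ≈⟨ ER.*-congˡ {δ} (ER.trans (emb-+ (s * a) b) (ER.+-congʳ {emb b} (emb-*E s a))) ⟩
    δ *E ((emb s *E emb a) +E emb b)                            ≈⟨ solve 5 (λ S A B τ τ̄ →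
         (τ :- τ̄) :* (S :* A :+ B)
      := (S :* τ :- con (+ 1)) :* (A :+ B :* τ̄) :+ (con (+ 1) :- S :* τ̄) :* (A :+ B :* τ))
      ER.refl (emb s) (emb a) (emb b) τE τ̄ ⟩
    (α (just s) *E (emb a +E (emb b *E τ̄))) +E (β (just s) *E (emb a +E (emb b *E τE)))
                                                                ≈⟨ ER.sym (ER.+-cong (ER.*-congˡ {α (just s)} (conj-decomposition u))
                                                                                      (ER.*-congˡ {β (just s)} (decomposition u))) ⟩
    (α (just s) *E conj u) +E (β (just s) *E u)                 ∎
  pencil-split nothing u@(a , b) = begin
    δ *E emb a                                                  ≈⟨ solve 4 (λ A B τ τ̄ →
         (τ :- τ̄) :* A := τ :* (A :+ B :* τ̄) :+ (:- τ̄) :* (A :+ B :* τ))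
      ER.refl (emb a) (emb b) τE τ̄ ⟩
    (τE *E (emb a +E (emb b *E τ̄))) +E ((ER.- τ̄) *E (emb a +E (emb b *E τE)))
                                                                ≈⟨ ER.sym (ER.+-cong (ER.*-congˡ {τE} (conj-decomposition u))
                                                                                      (ER.*-congˡ {ER.- τ̄} (decomposition u))) ⟩
    (τE *E conj u) +E ((ER.- τ̄) *E u)                           ∎

  pencil≡ : ∀ O t i j → pencil O t i j ≡ pencilCoefficient t (substituted O i j)
  pencil≡ O (just s) i j = P.refl
  pencil≡ O nothing  i j = P.refl

  pencil-value : ∀ O t v → (δ *E evalQ⋆ O t v) ≈E
    ((α t *E value (λ i j → conj (substituted O i j)) v) +E (β t *E value (substituted O) v))
  pencil-value O t v = begin
    δ *E evalQ⋆ O t v                      ≈⟨ ER.sym (value-scale δ Q v) ⟩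
    value (δ ·Q Q) v                       ≈⟨ value-cong v split ⟩
    value ((α t ·Q S̄) +Q (β t ·Q S)) v     ≈⟨ value-+ (α t ·Q S̄) (β t ·Q S) v ⟩
    value (α t ·Q S̄) v +E value (β t ·Q S) v ≈⟨ ER.+-cong (value-scale (α t) S̄ v) (value-scale (β t) S v) ⟩
    (α t *E value S̄ v) +E (β t *E value S v) ∎
    where
    S S̄ Q : QF5
    S = substituted O
    S̄ i j = conj (S i j)
    Q i j = emb (pencil O t i j)
    split : ∀ i j → (δ *E emb (pencil O t i j)) ≈E ((α t *E S̄ i j) +E (β t *E S i j))
    split i j rewrite pencil≡ O t i j = pencil-split t (S i j)

  evalConic-cong : ∀ O {x x′ y y′ z z′} → x ≈E x′ → y ≈E y′ → z ≈E z′ → evalConic O x y z ≈E evalConic O x′ y′ z′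
  evalConic-cong O {x} {x′} {y} {y′} {z} {z′} x≈ y≈ z≈ =
    ER.+-cong (ER.+-cong (ER.+-cong (ER.+-cong (ER.+-cong
      (ER.*-congˡ {ca} (ER.*-cong x≈ x≈)) (ER.*-congˡ {cb} (ER.*-cong y≈ y≈))) (ER.*-congˡ {cc} (ER.*-cong z≈ z≈)))
      (ER.*-congˡ {cd} (ER.*-cong x≈ y≈))) (ER.*-congˡ {ce} (ER.*-cong x≈ z≈))) (ER.*-congˡ {ch} (ER.*-cong y≈ z≈))
    where open Conic O

  evalConic-homogeneous : ∀ O k x y z → evalConic O (k *E x) (k *E y) (k *E z) ≈E ((k *E k) *E evalConic O x y z)
  evalConic-homogeneous O k x y z = solve 10 (λ a b c d e h k x y z →
         a :* ((k :* x) :* (k :* x)) :+ b :* ((k :* y) :* (k :* y)) :+ c :* ((k :* z) :* (k :* z))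
           :+ d :* ((k :* x) :* (k :* y)) :+ e :* ((k :* x) :* (k :* z)) :+ h :* ((k :* y) :* (k :* z))
    := (k :* k) :* (a :* (x :* x) :+ b :* (y :* y) :+ c :* (z :* z)
           :+ d :* (x :* y) :+ e :* (x :* z) :+ h :* (y :* z)))
    ER.refl ca cb cc cd ce ch k x y z
    where open Conic O

  evalConic-origin : ∀ O → evalConic O 0E 0E 0E ≈E 0E
  evalConic-origin O = solve 6 (λ a b c d e h →
         a :* (con (+ 0) :* con (+ 0)) :+ b :* (con (+ 0) :* con (+ 0)) :+ c :* (con (+ 0) :* con (+ 0))
           :+ d :* (con (+ 0) :* con (+ 0)) :+ e :* (con (+ 0) :* con (+ 0)) :+ h :* (con (+ 0) :* con (+ 0))
    := con (+ 0))
    ER.refl ca cb cc cd ce ch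
    where open Conic O

module Transversal {c ℓ : Level} (F : FiniteField c ℓ) (t0 t1 : FiniteField.Carrier F) where
  open import Data.Integer using (+_)
  open import Data.Fin using (Fin)
  open import Data.Fin.Patterns using (0F; 1F; 2F; 3F; 4F)
  open import Data.Maybe using (just; nothing)
  open import Relation.Nullary using (¬_)
  open import Function.Bundles using (_⇔_; mk⇔)

  open FiniteField F
  open BruckBose F t0 t1
  open QuadraticExtension F t0 t1
    using (module ER; module ES; τ̄; conj; conj-0; conj-1; conj-τ; 1-sτ̄≉0; -τ̄≉0; no-zero-divisors)
  open ES using (solve; _:=_; _:+_; _:-_; _:*_; :-_; con)
  open Frobenius F t0 t1 using (w≉τ; w≈τ̄; frob-τ)
  open QuadraticForms F t0 t1
  open import Algebra.Properties.Group ER.+-group using () renaming (x∙y⁻¹≈ε⇒x≈y to x-y≈0⇒x≈y)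
  open import Relation.Binary.Reasoning.Setoid ER.setoid

  -- X A₀ + Y A₁ = (X τ̄, -X, Y τ̄, -Y, 0), as A₀ = (τ^q, -1, 0, 0, 0) and
  -- A₁ = (0, 0, τ^q, -1, 0) with τ^q = τ̄ (frob-τ)
  gPoint : E → E → Fin 5 → E
  gPoint X Y 0F = X *E τ̄
  gPoint X Y 1F = -E X
  gPoint X Y 2F = Y *E τ̄
  gPoint X Y 3F = -E Y
  gPoint X Y 4F = 0E

  form-gPoint : ∀ L X Y → form L (gPoint X Y) ≈E ((X *E ((L 0F *E τ̄) ER.- L 1F)) +E (Y *E ((L 2F *E τ̄) ER.- L 3F)))
  form-gPoint L X Y = solve 8 (λ l₀ l₁ l₂ l₃ l₄ X Y τ̄ →
         l₀ :* (X :* τ̄) :+ (l₁ :* (:- X) :+ (l₂ :* (Y :* τ̄) :+ (l₃ :* (:- Y) :+ (l₄ :* con (+ 0) :+ con (+ 0)))))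
    := X :* (l₀ :* τ̄ :- l₁) :+ Y :* (l₂ :* τ̄ :- l₃))
    ER.refl (L 0F) (L 1F) (L 2F) (L 3F) (L 4F) X Y τ̄

  form-on-g : ∀ L X Y {a b c e} → L 0F ≈E a → L 1F ≈E b → L 2F ≈E c → L 3F ≈E e →
              form L (gPoint X Y) ≈E ((X *E ((a *E τ̄) ER.- b)) +E (Y *E ((c *E τ̄) ER.- e)))
  form-on-g L X Y L₀≈ L₁≈ L₂≈ L₃≈ = ER.trans (form-gPoint L X Y)
    (ER.+-cong (ER.*-congˡ {X} (ER.+-cong (ER.*-congʳ {τ̄} L₀≈) (ER.-‿cong L₁≈)))
               (ER.*-congˡ {Y} (ER.+-cong (ER.*-congʳ {τ̄} L₂≈) (ER.-‿cong L₃≈))))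

  d : E
  d = τ̄ ER.- τE

  x-on-g : ∀ X Y → form lx (gPoint X Y) ≈E (d *E X)
  x-on-g X Y = ER.trans (form-on-g lx X Y ER.refl ER.refl ER.refl ER.refl)
    (solve 4 (λ X Y τ τ̄ → X :* (con (+ 1) :* τ̄ :- τ) :+ Y :* (con (+ 0) :* τ̄ :- con (+ 0))
                           := (τ̄ :- τ) :* X) ER.refl X Y τE τ̄)

  y-on-g : ∀ X Y → form ly (gPoint X Y) ≈E (d *E Y)
  y-on-g X Y = ER.trans (form-on-g ly X Y ER.refl ER.refl ER.refl ER.refl)
    (solve 4 (λ X Y τ τ̄ → X :* (con (+ 0) :* τ̄ :- con (+ 0)) :+ Y :* (con (+ 1) :* τ̄ :- τ)
                           := (τ̄ :- τ) :* Y) ER.refl X Y τE τ̄)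

  z-on-g : ∀ X Y → form lz (gPoint X Y) ≈E (d *E 0E)
  z-on-g X Y = ER.trans (form-on-g lz X Y ER.refl ER.refl ER.refl ER.refl)
    (solve 4 (λ X Y τ τ̄ → X :* (con (+ 0) :* τ̄ :- con (+ 0)) :+ Y :* (con (+ 0) :* τ̄ :- con (+ 0))
                           := (τ̄ :- τ) :* con (+ 0)) ER.refl X Y τE τ̄)

  x̄-on-g : ∀ X Y → form (λ k → conj (lx k)) (gPoint X Y) ≈E 0E
  x̄-on-g X Y = ER.trans (form-on-g (λ k → conj (lx k)) X Y conj-1 conj-τ conj-0 conj-0)
    (solve 3 (λ X Y τ̄ → X :* (con (+ 1) :* τ̄ :- τ̄) :+ Y :* (con (+ 0) :* τ̄ :- con (+ 0))
                         := con (+ 0)) ER.refl X Y τ̄)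

  ȳ-on-g : ∀ X Y → form (λ k → conj (ly k)) (gPoint X Y) ≈E 0E
  ȳ-on-g X Y = ER.trans (form-on-g (λ k → conj (ly k)) X Y conj-0 conj-0 conj-1 conj-τ)
    (solve 3 (λ X Y τ̄ → X :* (con (+ 0) :* τ̄ :- con (+ 0)) :+ Y :* (con (+ 1) :* τ̄ :- τ̄)
                         := con (+ 0)) ER.refl X Y τ̄)

  z̄-on-g : ∀ X Y → form (λ k → conj (lz k)) (gPoint X Y) ≈E 0E
  z̄-on-g X Y = ER.trans (form-on-g (λ k → conj (lz k)) X Y conj-0 conj-0 conj-0 conj-0)
    (solve 3 (λ X Y τ̄ → X :* (con (+ 0) :* τ̄ :- con (+ 0)) :+ Y :* (con (+ 0) :* τ̄ :- con (+ 0))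
                         := con (+ 0)) ER.refl X Y τ̄)

  pencil-on-g : ∀ O t X Y v → (∀ i → v i ≈E gPoint X Y i) →
                (δ *E evalQ⋆ O t v) ≈E (β t *E ((d *E d) *E evalConic O X Y 0E))
  pencil-on-g O t X Y v v≈ = begin
    δ *E evalQ⋆ O t v                          ≈⟨ pencil-value O t v ⟩
    (α t *E value S̄ v) +E (β t *E value S v)   ≈⟨ ER.+-cong (ER.*-congˡ {α t} S̄≈0) (ER.*-congˡ {β t} S≈d²f) ⟩
    (α t *E 0E) +E (β t *E (d² *E f))          ≈⟨ solve 3 (λ a b x → a :* con (+ 0) :+ b :* x := b :* x)
                                                     ER.refl (α t) (β t) (d² *E f) ⟩
    β t *E (d² *E f)                           ∎
    where
    S S̄ : QF5
    S = substituted O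
    S̄ i j = conj (S i j)
    f d² : E
    f = evalConic O X Y 0E
    d² = d *E d
    on-g : ∀ L {r} → form L (gPoint X Y) ≈E r → form L v ≈E r
    on-g L L≈r = ER.trans (form-cong L v≈) L≈r
    S≈d²f : value S v ≈E (d² *E f)
    S≈d²f = begin
      value S v                                        ≈⟨ value-substitute O lx ly lz v ⟩
      evalConic O (form lx v) (form ly v) (form lz v)  ≈⟨ evalConic-cong O (on-g lx (x-on-g X Y)) (on-g ly (y-on-g X Y)) (on-g lz (z-on-g X Y)) ⟩
      evalConic O (d *E X) (d *E Y) (d *E 0E)          ≈⟨ evalConic-homogeneous O d X Y 0E ⟩
      d² *E f                                          ∎
    S̄≈0 : value S̄ v ≈E 0E
    S̄≈0 = begin
      value S̄ v                                        ≈⟨ value-cong v (conj-substitute O lx ly lz) ⟩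
      value (substitute (conjugate O) x̄ ȳ z̄) v         ≈⟨ value-substitute (conjugate O) x̄ ȳ z̄ v ⟩
      evalConic (conjugate O) (form x̄ v) (form ȳ v) (form z̄ v)
                                                       ≈⟨ evalConic-cong (conjugate O) (on-g x̄ (x̄-on-g X Y)) (on-g ȳ (ȳ-on-g X Y)) (on-g z̄ (z̄-on-g X Y)) ⟩
      evalConic (conjugate O) 0E 0E 0E                 ≈⟨ evalConic-origin (conjugate O) ⟩
      0E                                               ∎
      where
      x̄ ȳ z̄ : Fin 5 → E
      x̄ k = conj (lx k)
      ȳ k = conj (ly k)
      z̄ k = conj (lz k)

  -- the factors in pencil-on-g do not vanish: τ ≉ τ̄ because the Frobenius
  -- image of τ is τ̄ but differs from τ
  τ≉τ̄ : Irreducible → ¬ τE ≈E τ̄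
  τ≉τ̄ irr τ≈τ̄ = w≉τ irr (ER.trans (w≈τ̄ irr) (ER.sym τ≈τ̄))

  δ≉0 : Irreducible → ¬ δ ≈E 0E
  δ≉0 irr δ≈0 = τ≉τ̄ irr (x-y≈0⇒x≈y τE τ̄ δ≈0)

  d≉0 : Irreducible → ¬ d ≈E 0E
  d≉0 irr d≈0 = τ≉τ̄ irr (ER.sym (x-y≈0⇒x≈y τ̄ τE d≈0))

  β≉0 : ∀ t → ¬ β t ≈E 0E
  β≉0 (just s) = 1-sτ̄≉0 s
  β≉0 nothing  = -τ̄≉0

  on-g-iff : Irreducible → ∀ O t X Y v → (∀ i → v i ≈E gPoint X Y i) →
             evalQ⋆ O t v ≈E 0E ⇔ evalConic O X Y 0E ≈E 0E
  on-g-iff irr O t X Y v v≈ = mk⇔ to from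
    where
    f : E
    f = evalConic O X Y 0E
    identity : (δ *E evalQ⋆ O t v) ≈E (β t *E ((d *E d) *E f))
    identity = pencil-on-g O t X Y v v≈
    to : evalQ⋆ O t v ≈E 0E → f ≈E 0E
    to Q≈0 = no-zero-divisors irr d f df≈0 (d≉0 irr)
      where
      βd²f≈0 : (β t *E ((d *E d) *E f)) ≈E 0E
      βd²f≈0 = ER.trans (ER.sym identity) (ER.trans (ER.*-congˡ {δ} Q≈0) (ER.zeroʳ δ))
      d²f≈0 : ((d *E d) *E f) ≈E 0E
      d²f≈0 = no-zero-divisors irr (β t) _ βd²f≈0 (β≉0 t)
      df≈0 : (d *E f) ≈E 0E
      df≈0 = no-zero-divisors irr d (d *E f) (ER.trans (ER.sym (ER.*-assoc d d f)) d²f≈0) (d≉0 irr)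
    from : f ≈E 0E → evalQ⋆ O t v ≈E 0E
    from f≈0 = no-zero-divisors irr δ (evalQ⋆ O t v) δQ≈0 (δ≉0 irr)
      where
      δQ≈0 : (δ *E evalQ⋆ O t v) ≈E 0E
      δQ≈0 = ER.trans identity (ER.trans (ER.*-congˡ {β t} (ER.trans (ER.*-congˡ {d *E d} f≈0) (ER.zeroʳ (d *E d)))) (ER.zeroʳ (β t)))

  pointOfG-on-g : Irreducible → ∀ μ i → pointOfG μ i ≈E gPoint 1E μ i
  pointOfG-on-g irr μ 0F = ER.trans (ER.+-congʳ {μ *E 0E} (frob-τ irr))
    (solve 2 (λ τ̄ μ → τ̄ :+ μ :* con (+ 0) := con (+ 1) :* τ̄) ER.refl τ̄ μ)
  pointOfG-on-g irr μ 1F = solve 1 (λ μ → :- con (+ 1) :+ μ :* con (+ 0) := :- con (+ 1)) ER.refl μ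
  pointOfG-on-g irr μ 2F = ER.trans (ER.+-congˡ {0E} (ER.*-congˡ {μ} (frob-τ irr)))
    (solve 2 (λ τ̄ μ → con (+ 0) :+ μ :* τ̄ := μ :* τ̄) ER.refl τ̄ μ)
  pointOfG-on-g irr μ 3F = solve 1 (λ μ → con (+ 0) :+ μ :* (:- con (+ 1)) := :- μ) ER.refl μ
  pointOfG-on-g irr μ 4F = solve 1 (λ μ → con (+ 0) :+ μ :* con (+ 0) := con (+ 0)) ER.refl μ

  A1-on-g : Irreducible → ∀ i → A1 i ≈E gPoint 0E 1E i
  A1-on-g irr 0F = ER.sym (ER.zeroˡ τ̄)
  A1-on-g irr 1F = solve 0 (con (+ 0) := :- con (+ 0)) ER.refl
  A1-on-g irr 2F = ER.trans (frob-τ irr) (ER.sym (ER.*-identityˡ τ̄))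
  A1-on-g irr 3F = ER.refl
  A1-on-g irr 4F = ER.refl

module Counting {c ℓ : Level} (F : FiniteField c ℓ) (t0 t1 : FiniteField.Carrier F) where
  open import Relation.Nullary using (Dec; yes; no)
  open import Relation.Nullary.Negation using (contradiction)
  open import Function.Bundles using (_⇔_; Equivalence)
  import Relation.Binary.PropositionalEquality as P
  open BruckBose F t0 t1 using (indicator)

  indicator-cong : ∀ {A B : Set ℓ} (a : Dec A) (b : Dec B) → A ⇔ B → indicator a ≡ indicator b
  indicator-cong (yes _) (yes _) _   = P.refl
  indicator-cong (yes a) (no ¬b) A⇔B = contradiction (Equivalence.to A⇔B a) ¬b
  indicator-cong (no ¬a) (yes b) A⇔B = contradiction (Equivalence.from A⇔B b) ¬a
  indicator-cong (no _)  (no _)  _   = P.refl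

theorem4p1 : {c ℓ : Level} (F : FiniteField c ℓ) (t0 t1 : FiniteField.Carrier F) →
    BruckBose.Irreducible F t0 t1 → BruckBose.Primitive F t0 t1 →
    (O : BruckBose.Conic F t0 t1) → BruckBose.NonDegenerate F t0 t1 O →
    (t : Maybe (FiniteField.Carrier F)) →
    BruckBose.#g∩Q⋆ F t0 t1 O t ≡ BruckBose.#O∩ℓ∞ F t0 t1 O
theorem4p1 F t0 t1 irreducible _ O _ t = P.cong₂ _+_ points-A₀+μA₁ point-A₁
  where
  open import Data.Nat using (_+_)
  open import Data.List using (length; filter)
  open import Data.List.Properties using (filter-≐)
  open import Data.Product using (_,_)
  open import Relation.Nullary using (Dec)
  open import Function.Bundles using (_⇔_; Equivalence)
  open import Relation.Unary using (_≐_)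
  import Relation.Binary.PropositionalEquality as P
  open BruckBose F t0 t1
  open Transversal F t0 t1 using (on-g-iff; pointOfG-on-g; A1-on-g)
  open Counting F t0 t1 using (indicator-cong)

  on-Q⋆? : ∀ μ → Dec (evalQ⋆ O t (pointOfG μ) ≈E 0E)
  on-Q⋆? μ = evalQ⋆ O t (pointOfG μ) ≟E 0E
  on-O? : ∀ μ → Dec (evalConic O 1E μ 0E ≈E 0E)
  on-O? μ = evalConic O 1E μ 0E ≟E 0E
  on-g : ∀ μ → evalQ⋆ O t (pointOfG μ) ≈E 0E ⇔ evalConic O 1E μ 0E ≈E 0E
  on-g μ = on-g-iff irreducible O t 1E μ (pointOfG μ) (pointOfG-on-g irreducible μ)
  same-points : (λ μ → evalQ⋆ O t (pointOfG μ) ≈E 0E) ≐ (λ μ → evalConic O 1E μ 0E ≈E 0E)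
  same-points = (λ {μ} → Equivalence.to (on-g μ)) , (λ {μ} → Equivalence.from (on-g μ))
  points-A₀+μA₁ : length (filter on-Q⋆? elemsE) ≡ length (filter on-O? elemsE)
  points-A₀+μA₁ = P.cong length (filter-≐ on-Q⋆? on-O? same-points elemsE)

  point-A₁ : indicator (evalQ⋆ O t A1 ≟E 0E) ≡ indicator (evalConic O 0E 1E 0E ≟E 0E)
  point-A₁ = indicator-cong _ _ (on-g-iff irreducible O t 0E 1E A1 (A1-on-g irreducible))
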